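{- Let $f\in\mathbb{Q}\langle C\rangle$ be homogeneous of degree $n$ in $x,y$ and of homogeneous depth $r$, and $g\in\mathbb{Q}\langle C\rangle$ homogeneous of degree $m$ and of homogeneous depth $s$. Let $D_f$ be the derivation of $\mathbb{Q}\langle x,y\rangle$ with $D_f(x)=0$, $D_f(y)=[y,f]$. Then $ma_{D_f(g)}=-\,arit(ma_f)\cdot ma_g$.
   Context: $C_i=\mathrm{ad}(x)^{i-1}(y)$; $\mathbb{Q}\langle C\rangle$ is the subring of $\mathbb{Q}\langle x,y\rangle$ freely generated by the $C_i$, $i\ge1$; each element has a unique expression as a polynomial in the $C_i$. Depth = number of letters $y$ in a monomial (= degree in the $C_i$). For $h$ homogeneous of degree $n$ and depth $r$, written $h=\sum c_{\mathbf a}C_{a_1}\cdots C_{a_r}$, $ma_h$ is the mould concentrated in depth $r$ with $ma_h(u_1,\dots,u_r)=(-1)^{r+n}\sum c_{\mathbf a}u_1^{a_1-1}\cdots u_r^{a_r-1}$ (extended linearly). Moulds are families of functions $A(u_1,\dots,u_r)$. For $\mathbf w=(u_1,\dots,u_r)=\mathbf a\mathbf b\mathbf c$ with $\mathbf a=(u_1..u_k)$, $\mathbf b=(u_{k+1}..u_{k+l})$, $\mathbf c=(u_{k+l+1}..u_r)$: if $\mathbf b,\mathbf c\ne\emptyset$, $\mathbf a\lceil\mathbf c=(u_1,\dots,u_k,u_{k+1}+\dots+u_{k+l+1},u_{k+l+2},\dots,u_r)$; if $\mathbf a,\mathbf b\ne\emptyset$, $\mathbf a\rceil\mathbf c=(u_1,\dots,u_{k-1},u_k+\dots+u_{k+l},u_{k+l+1},\dots,u_r)$.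 $(arit(B)A)(\mathbf w)=\sum_{\mathbf w=\mathbf a\mathbf b\mathbf c,\,\mathbf b,\mathbf c\ne\emptyset}A(\mathbf a\lceil\mathbf c)B(\mathbf b)-\sum_{\mathbf w=\mathbf a\mathbf b\mathbf c,\,\mathbf a,\mathbf b\ne\emptyset}A(\mathbf a\rceil\mathbf c)B(\mathbf b)$. -}

module Defs where

open import Data.Nat as ℕ using (ℕ; zero; suc)
open import Data.Bool using (Bool; true; false; if_then_else_)
open import Data.Product using (_×_; _,_)
open import Data.List using (List; []; _∷_; _++_; map; concatMap; length; foldr)
open import Data.List.Properties using (≡-dec)
open import Data.Rational using (ℚ; 0ℚ; 1ℚ; _+_; _*_; -_; _-_)
open import Relation.Binary.PropositionalEquality using (_≡_; refl)
open import Relation.Nullary using (yes; no; does)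

data Letter : Set where
  x y : Letter

_≟L_ : (a b : Letter) → Relation.Nullary.Dec (a ≡ b)
x ≟L x = yes refl
x ≟L y = no λ ()
y ≟L x = no λ ()
y ≟L y = yes refl

Word : Set
Word = List Letter

-- an element of ℚ⟨x,y⟩ as a finite formal ℚ-linear combination of words
Poly : Set
Poly = List (ℚ × Word)

coeff : Poly → Word → ℚ
coeff [] w = 0ℚ
coeff ((c , v) ∷ p) w =
  (if does (≡-dec _≟L_ v w) then c else 0ℚ) + coeff p w

_≈P_ : Poly → Poly → Set
p ≈P q = ∀ w → coeff p w ≡ coeff q w

countY : Word → ℕ
countY [] = 0
countY (x ∷ w) = countY w
countY (y ∷ w) = suc (countY w)

HomogeneousP : ℕ → ℕ → Poly → Set
HomogeneousP n r p =
  ∀ w → (coeff p w ≡ 0ℚ → Data.Empty.⊥) → (length w ≡ n) × (countY w ≡ r)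
  where import Data.Empty

letter : Letter → Poly
letter l = (1ℚ , l ∷ []) ∷ []

scaleP : ℚ → Poly → Poly
scaleP a = map (λ { (c , w) → (a * c , w) })

negP : Poly → Poly
negP = scaleP (- 1ℚ)

_+P_ : Poly → Poly → Poly
_+P_ = _++_

_-P_ : Poly → Poly → Poly
p -P q = p ++ negP q

_*P_ : Poly → Poly → Poly
p *P q = concatMap (λ { (c , v) → map (λ { (d , w) → (c * d , v ++ w) }) q }) p

bracket : Poly → Poly → Poly
bracket p q = (p *P q) -P (q *P p)

adxPow : ℕ → Poly
adxPow zero = letter y
adxPow (suc k) = bracket (letter x) (adxPow k)

-- Convention: an index entry k ∈ ℕ stands for the generator C_{k+1}
-- (so that all indices are ≥ 1).  C_{k+1} = ad(x)^k (y).
Cgen : ℕ → Poly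
Cgen k = adxPow k

-- a monomial C_{a_1} ⋯ C_{a_r} is the list (a_1 - 1, …, a_r - 1)
CMon : Set
CMon = List ℕ

CPoly : Set
CPoly = List (ℚ × CMon)

evalMon : CMon → Poly
evalMon [] = (1ℚ , []) ∷ []
evalMon (k ∷ ks) = Cgen k *P evalMon ks

evalC : CPoly → Poly
evalC [] = []
evalC ((c , m) ∷ h) = scaleP c (evalMon m) +P evalC h

DLetter : Poly → Letter → Poly
DLetter f x = []
DLetter f y = bracket (letter y) f

DWord : Poly → Word → Poly
DWord f [] = []
DWord f (l ∷ w) =
  (DLetter f l *P ((1ℚ , w) ∷ [])) +P (letter l *P DWord f w)

Dder : Poly → Poly → Poly
Dder f [] = []
Dder f ((c , w) ∷ p) = scaleP c (DWord f w) +P Dder f p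

-- A mould: a family of functions A(u₁,…,u_r), r ≥ 0; the depth r is
-- the length of the argument list.
Mould : Set
Mould = List ℚ → ℚ

_≈M_ : Mould → Mould → Set
A ≈M B = ∀ us → A us ≡ B us

negM : Mould → Mould
negM A us = - (A us)

powℚ : ℚ → ℕ → ℚ
powℚ q zero = 1ℚ
powℚ q (suc k) = q * powℚ q k

sgn : ℕ → ℚ
sgn zero = 1ℚ
sgn (suc k) = - (sgn k)

degMon : CMon → ℕ
degMon = foldr (λ k n → suc k ℕ.+ n) 0

-- u₁^{a₁-1} ⋯ u_r^{a_r-1}, and 0 if the number of variables is not r
monVal : CMon → List ℚ → ℚ
monVal [] [] = 1ℚ
monVal [] (_ ∷ _) = 0ℚ
monVal (_ ∷ _) [] = 0ℚ
monVal (k ∷ ks) (u ∷ us) = powℚ u k * monVal ks us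

-- ma_h, extended linearly: each monomial c C_{a_1}⋯C_{a_r} contributes
-- (-1)^{r+n} c u₁^{a₁-1}⋯u_r^{a_r-1} in depth r (n = a₁+⋯+a_r).
ma : CPoly → Mould
ma [] us = 0ℚ
ma ((c , m) ∷ h) us =
  (sgn (length m ℕ.+ degMon m) * (c * monVal m us)) + ma h us

sumℚ : List ℚ → ℚ
sumℚ = foldr _+_ 0ℚ

sumL : List ℚ → ℚ
sumL = sumℚ

splits : List ℚ → List (List ℚ × List ℚ)
splits [] = ([] , []) ∷ []
splits (u ∷ w) = ([] , u ∷ w) ∷ map (λ { (a , b) → (u ∷ a , b) }) (splits w)

splits3 : List ℚ → List (List ℚ × List ℚ × List ℚ)
splits3 w = concatMap (λ { (a , r) → map (λ { (b , c) → (a , b , c) }) (splits r) }) (splits w)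

addLast : ℚ → List ℚ → List ℚ
addLast s [] = []
addLast s (u ∷ []) = (u + s) ∷ []
addLast s (u ∷ v ∷ us) = u ∷ addLast s (v ∷ us)

-- A(a⌈c) B(b) when b, c ≠ ∅, else 0
termL : Mould → Mould → List ℚ → List ℚ → List ℚ → ℚ
termL A B a [] c = 0ℚ
termL A B a (b ∷ bs) [] = 0ℚ
termL A B a (b ∷ bs) (c ∷ cs) = A (a ++ ((sumℚ (b ∷ bs) + c) ∷ cs)) * B (b ∷ bs)

-- A(a⌉c) B(b) when a, b ≠ ∅, else 0
termR : Mould → Mould → List ℚ → List ℚ → List ℚ → ℚ
termR A B [] b c = 0ℚ
termR A B (a ∷ as) [] c = 0ℚ
termR A B (a ∷ as) (b ∷ bs) c = A (addLast (sumℚ (b ∷ bs)) (a ∷ as) ++ c) * B (b ∷ bs)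

arit : Mould → Mould → Mould
arit B A w =
  sumℚ (map (λ { (a , b , c) → termL A B a b c }) (splits3 w))
  - sumℚ (map (λ { (a , b , c) → termR A B a b c }) (splits3 w))

module Submission where

-- Everything is tested against linear functionals: φ on words extends to
-- lin φ on ℚ⟨x,y⟩, and equal coefficients give equal values.  Existence: ℚ⟨C⟩ is closed under ad(x) and
-- [y,-], so D_f(C_{k+1} m) = ad(x)^k [y,f] · m + C_{k+1} D_f(m) gives an
-- explicit preimage of D_f(g).  Uniqueness of the mould: a single functional
-- weight (levels us) satisfies ma h us = lin (weight (levels us)) (evalC h),
-- so ma h only depends on evalC h (no freeness of ℚ⟨C⟩ is needed).  The
-- formula: transposing D_f makes weight (levels us) (D_f g) bilinear in f and
-- g; arit is bilinear too (its terms have a uniform shape), so it suffices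
-- to compare one monomial of f with one word of g, by induction on the word
-- (transposeD-monomial).

open import Defs
open import Data.Nat as ℕ using (ℕ; zero; suc; _≤_; z≤n; s≤s)
import Data.Nat.Properties as ℕₚ
open import Data.Bool using (true; false; if_then_else_)
open import Data.Product using (Σ; _×_; _,_; proj₁; proj₂)
open import Data.List using (List; []; _∷_; _++_; map; concatMap; length)
open import Data.List.Properties using (≡-dec; ++-assoc; ++-identityʳ)
open import Data.List.Relation.Unary.All using (All; []; _∷_)
open import Data.List.Relation.Unary.All.Properties using (gmap⁺; concat⁺)
open import Data.Rational using (ℚ; 0ℚ; 1ℚ; _+_; _*_; -_; _-_)
open import Data.Rational.Solver using (module +-*-Solver)
open +-*-Solver using (solve; _:+_; _:*_; :-_; _:-_; _:=_; con)
open import Data.Empty using (⊥-elim)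
open import Relation.Nullary using (yes; no; does; ¬_)
open import Relation.Binary.PropositionalEquality
open ≡-Reasoning

lin : {A : Set} → (A → ℚ) → List (ℚ × A) → ℚ
lin φ [] = 0ℚ
lin φ ((c , a) ∷ p) = c * φ a + lin φ p

module _ {A : Set} where

  lin-++ : (φ : A → ℚ) (p q : List (ℚ × A)) → lin φ (p ++ q) ≡ lin φ p + lin φ q
  lin-++ φ [] q = solve 1 (λ a → a := con 0ℚ :+ a) refl (lin φ q)
  lin-++ φ ((c , a) ∷ p) q rewrite lin-++ φ p q =
    solve 3 (λ x y z → x :+ (y :+ z) := (x :+ y) :+ z) refl (c * φ a) (lin φ p) (lin φ q)

  lin-single : (φ : A → ℚ) (a : A) → lin φ ((1ℚ , a) ∷ []) ≡ φ a
  lin-single φ a = solve 1 (λ f → con 1ℚ :* f :+ con 0ℚ := f) refl (φ a)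

  lin-congᴬ : (φ ψ : A → ℚ) (p : List (ℚ × A)) →
    All (λ e → φ (proj₂ e) ≡ ψ (proj₂ e)) p → lin φ p ≡ lin ψ p
  lin-congᴬ φ ψ [] [] = refl
  lin-congᴬ φ ψ ((c , a) ∷ p) (e ∷ es) = cong₂ (λ s t → c * s + t) e (lin-congᴬ φ ψ p es)

  lin-cong : (φ ψ : A → ℚ) (p : List (ℚ × A)) → (∀ a → φ a ≡ ψ a) → lin φ p ≡ lin ψ p
  lin-cong φ ψ [] e = refl
  lin-cong φ ψ ((c , a) ∷ p) e = cong₂ (λ s t → c * s + t) (e a) (lin-cong φ ψ p e)

  lin-zero : (φ : A → ℚ) (p : List (ℚ × A)) → (∀ a → φ a ≡ 0ℚ) → lin φ p ≡ 0ℚ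
  lin-zero φ [] e = refl
  lin-zero φ ((c , a) ∷ p) e rewrite e a | lin-zero φ p e =
    solve 1 (λ c → c :* con 0ℚ :+ con 0ℚ := con 0ℚ) refl c

  lin-linear : (φ ψ : A → ℚ) (k : ℚ) (p : List (ℚ × A)) →
    lin (λ a → k * φ a + ψ a) p ≡ k * lin φ p + lin ψ p
  lin-linear φ ψ k [] = solve 1 (λ k → con 0ℚ := k :* con 0ℚ :+ con 0ℚ) refl k
  lin-linear φ ψ k ((c , a) ∷ p) rewrite lin-linear φ ψ k p =
    solve 6 (λ c k f g l m → c :* (k :* f :+ g) :+ (k :* l :+ m) := k :* (c :* f :+ l) :+ (c :* g :+ m))
      refl c k (φ a) (ψ a) (lin φ p) (lin ψ p)

  lin-scale : (φ : A → ℚ) (k : ℚ) (p : List (ℚ × A)) → lin (λ a → k * φ a) p ≡ k * lin φ p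
  lin-scale φ k p = begin
      lin (λ a → k * φ a) p
    ≡⟨ lin-cong _ _ p (λ a → solve 2 (λ k f → k :* f := k :* f :+ con 0ℚ) refl k (φ a)) ⟩
      lin (λ a → k * φ a + 0ℚ) p
    ≡⟨ lin-linear φ (λ _ → 0ℚ) k p ⟩
      k * lin φ p + lin (λ _ → 0ℚ) p
    ≡⟨ cong (k * lin φ p +_) (lin-zero _ p (λ _ → refl)) ⟩
      k * lin φ p + 0ℚ
    ≡⟨ solve 1 (λ x → x :+ con 0ℚ := x) refl (k * lin φ p) ⟩
      k * lin φ p
    ∎

  lin-scaleʳ : (φ : A → ℚ) (k : ℚ) (p : List (ℚ × A)) → lin (λ a → φ a * k) p ≡ lin φ p * k
  lin-scaleʳ φ k p =
    trans (lin-cong _ _ p (λ a → solve 2 (λ k f → f :* k := k :* f) refl k (φ a)))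
      (trans (lin-scale φ k p) (solve 2 (λ k x → k :* x := x :* k) refl k (lin φ p)))

  lin-add : (φ ψ : A → ℚ) (p : List (ℚ × A)) → lin (λ a → φ a + ψ a) p ≡ lin φ p + lin ψ p
  lin-add φ ψ p =
    trans (lin-cong _ _ p (λ a → solve 2 (λ f g → f :+ g := con 1ℚ :* f :+ g) refl (φ a) (ψ a)))
      (trans (lin-linear φ ψ 1ℚ p) (cong (_+ lin ψ p) (solve 1 (λ x → con 1ℚ :* x := x) refl (lin φ p))))

  lin-neg : (φ : A → ℚ) (p : List (ℚ × A)) → lin (λ a → - φ a) p ≡ - lin φ p
  lin-neg φ p =
    trans (lin-cong _ _ p (λ a → solve 1 (λ f → :- f := con (- 1ℚ) :* f) refl (φ a)))
      (trans (lin-scale φ (- 1ℚ) p) (solve 1 (λ x → con (- 1ℚ) :* x := :- x) refl (lin φ p)))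

  lin-sub : (φ ψ : A → ℚ) (p : List (ℚ × A)) → lin (λ a → φ a - ψ a) p ≡ lin φ p - lin ψ p
  lin-sub φ ψ p = trans (lin-add φ (λ a → - ψ a) p) (cong (lin φ p +_) (lin-neg ψ p))

lin-swap : {A B : Set} (K : A → B → ℚ) (p : List (ℚ × A)) (q : List (ℚ × B)) →
  lin (λ a → lin (K a) q) p ≡ lin (λ b → lin (λ a → K a b) p) q
lin-swap K [] q = sym (lin-zero _ q (λ _ → refl))
lin-swap K ((c , a) ∷ p) q rewrite lin-swap K p q = sym (lin-linear (K a) (λ b → lin (λ a → K a b) p) c q)

lin-scaleP : (φ : Word → ℚ) (a : ℚ) (p : Poly) → lin φ (scaleP a p) ≡ a * lin φ p
lin-scaleP φ a [] = solve 1 (λ a → con 0ℚ := a :* con 0ℚ) refl a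
lin-scaleP φ a ((c , w) ∷ p) rewrite lin-scaleP φ a p =
  solve 4 (λ a c f l → a :* c :* f :+ a :* l := a :* (c :* f :+ l)) refl a c (φ w) (lin φ p)

lin-negP : (φ : Word → ℚ) (p : Poly) → lin φ (negP p) ≡ - lin φ p
lin-negP φ p = trans (lin-scaleP φ (- 1ℚ) p) (solve 1 (λ x → con (- 1ℚ) :* x := :- x) refl (lin φ p))

lin-subP : (φ : Word → ℚ) (p q : Poly) → lin φ (p -P q) ≡ lin φ p - lin φ q
lin-subP φ p q = trans (lin-++ φ p (negP q)) (cong (lin φ p +_) (lin-negP φ q))

lin-mulP : (φ : Word → ℚ) (p q : Poly) → lin φ (p *P q) ≡ lin (λ v → lin (λ u → φ (v ++ u)) q) p
lin-mulP φ [] q = refl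
lin-mulP φ ((c , v) ∷ p) q =
  trans (lin-++ φ (map (λ e → (c * proj₁ e , v ++ proj₂ e)) q) (p *P q))
        (cong₂ _+_ (prefix q) (lin-mulP φ p q))
  where
    prefix : (q : Poly) →
      lin φ (map (λ e → (c * proj₁ e , v ++ proj₂ e)) q) ≡ c * lin (λ u → φ (v ++ u)) q
    prefix [] = solve 1 (λ a → con 0ℚ := a :* con 0ℚ) refl c
    prefix ((d , w) ∷ q) rewrite prefix q =
      solve 4 (λ a c f l → a :* c :* f :+ a :* l := a :* (c :* f :+ l))
        refl c d (φ (v ++ w)) (lin (λ u → φ (v ++ u)) q)

lin-letter : (φ : Word → ℚ) (l : Letter) → lin φ (letter l) ≡ φ (l ∷ [])
lin-letter φ l = lin-single φ (l ∷ [])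

lin-lmul : (φ : Word → ℚ) (l : Letter) (p : Poly) → lin φ (letter l *P p) ≡ lin (λ u → φ (l ∷ u)) p
lin-lmul φ l p = trans (lin-mulP φ (letter l) p) (lin-letter (λ v → lin (λ u → φ (v ++ u)) p) l)

lin-rmul : (φ : Word → ℚ) (l : Letter) (p : Poly) → lin φ (p *P letter l) ≡ lin (λ u → φ (u ++ l ∷ [])) p
lin-rmul φ l p = trans (lin-mulP φ p (letter l)) (lin-cong _ _ p (λ v → lin-letter (λ u → φ (v ++ u)) l))

lin-bracket : (φ : Word → ℚ) (l : Letter) (p : Poly) →
  lin φ (bracket (letter l) p) ≡ lin (λ u → φ (l ∷ u) - φ (u ++ l ∷ [])) p
lin-bracket φ l p = trans (lin-subP φ (letter l *P p) (p *P letter l))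
  (trans (cong₂ _-_ (lin-lmul φ l p) (lin-rmul φ l p)) (sym (lin-sub _ _ p)))

δ : Word → Word → ℚ
δ w v = if does (≡-dec _≟L_ v w) then 1ℚ else 0ℚ

coeff-lin : (p : Poly) (w : Word) → coeff p w ≡ lin (δ w) p
coeff-lin [] w = refl
coeff-lin ((c , v) ∷ p) w rewrite coeff-lin p w with does (≡-dec _≟L_ v w)
... | true = cong (_+ lin (δ w) p) (solve 1 (λ c → c := c :* con 1ℚ) refl c)
... | false = cong (_+ lin (δ w) p) (solve 1 (λ c → con 0ℚ := c :* con 0ℚ) refl c)

lin⇒≈P : (p q : Poly) → (∀ φ → lin φ p ≡ lin φ q) → p ≈P q
lin⇒≈P p q e w = trans (coeff-lin p w) (trans (e (δ w)) (sym (coeff-lin q w)))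

-- For the converse, an element with vanishing coefficients is annihilated
-- by every functional: remove all terms on one word and recurse.

dropWord : Word → Poly → Poly
dropWord v [] = []
dropWord v ((c , w) ∷ r) = if does (≡-dec _≟L_ w v) then dropWord v r else (c , w) ∷ dropWord v r

lin-dropWord : (φ : Word → ℚ) (v : Word) (r : Poly) → lin φ r ≡ coeff r v * φ v + lin φ (dropWord v r)
lin-dropWord φ v [] = solve 1 (λ a → con 0ℚ := con 0ℚ :* a :+ con 0ℚ) refl (φ v)
lin-dropWord φ v ((c , w) ∷ r) with ≡-dec _≟L_ w v
... | yes refl rewrite lin-dropWord φ w r =
  solve 4 (λ c f k l → c :* f :+ (k :* f :+ l) := (c :+ k) :* f :+ l) refl c (φ w) (coeff r w) (lin φ (dropWord w r))
... | no _ rewrite lin-dropWord φ v r =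
  solve 5 (λ c fw fv k l → c :* fw :+ (k :* fv :+ l) := (con 0ℚ :+ k) :* fv :+ (c :* fw :+ l))
    refl c (φ w) (φ v) (coeff r v) (lin φ (dropWord v r))

does-no : (a b : Word) → ¬ (a ≡ b) → does (≡-dec _≟L_ a b) ≡ false
does-no a b ne with ≡-dec _≟L_ a b
... | yes e = ⊥-elim (ne e)
... | no _ = refl

coeff-dropWord-same : (v : Word) (r : Poly) → coeff (dropWord v r) v ≡ 0ℚ
coeff-dropWord-same v [] = refl
coeff-dropWord-same v ((c , w) ∷ r) with ≡-dec _≟L_ w v
... | yes refl = coeff-dropWord-same v r
... | no ne rewrite does-no w v ne | coeff-dropWord-same v r = refl

coeff-dropWord-other : (v w : Word) (r : Poly) → ¬ (v ≡ w) → coeff (dropWord v r) w ≡ coeff r w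
coeff-dropWord-other v w [] ne = refl
coeff-dropWord-other v w ((c , u) ∷ r) ne with ≡-dec _≟L_ u v
... | yes refl rewrite does-no u w ne =
  trans (coeff-dropWord-other v w r ne) (solve 1 (λ a → a := con 0ℚ :+ a) refl (coeff r w))
... | no _ = cong ((if does (≡-dec _≟L_ u w) then c else 0ℚ) +_) (coeff-dropWord-other v w r ne)

dropWord-head : (v : Word) (c : ℚ) (r : Poly) → dropWord v ((c , v) ∷ r) ≡ dropWord v r
dropWord-head v c r with ≡-dec _≟L_ v v
... | yes _ = refl
... | no ne = ⊥-elim (ne refl)

length-dropWord : (v : Word) (r : Poly) → length (dropWord v r) ≤ length r
length-dropWord v [] = z≤n
length-dropWord v ((c , w) ∷ r) with does (≡-dec _≟L_ w v)
... | true = ℕₚ.m≤n⇒m≤1+n (length-dropWord v r)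
... | false = s≤s (length-dropWord v r)

lin-vanishing : (φ : Word → ℚ) (n : ℕ) (r : Poly) → length r ≤ n → (∀ w → coeff r w ≡ 0ℚ) → lin φ r ≡ 0ℚ
lin-vanishing φ n [] _ _ = refl
lin-vanishing φ (suc n) r@((c , v) ∷ r') (s≤s len) zero-coeffs = begin
    lin φ r
  ≡⟨ lin-dropWord φ v r ⟩
    coeff r v * φ v + lin φ (dropWord v r)
  ≡⟨ cong₂ (λ a b → a * φ v + lin φ b) (zero-coeffs v) (dropWord-head v c r') ⟩
    0ℚ * φ v + lin φ (dropWord v r')
  ≡⟨ cong (0ℚ * φ v +_) (lin-vanishing φ n (dropWord v r') (ℕₚ.≤-trans (length-dropWord v r') len) rest-zero) ⟩
    0ℚ * φ v + 0ℚ
  ≡⟨ solve 1 (λ a → con 0ℚ :* a :+ con 0ℚ := con 0ℚ) refl (φ v) ⟩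
    0ℚ
  ∎
  where
    rest-zero : ∀ w → coeff (dropWord v r') w ≡ 0ℚ
    rest-zero w with ≡-dec _≟L_ v w
    ... | yes refl = trans (cong (λ t → coeff t v) (sym (dropWord-head v c r'))) (coeff-dropWord-same v r)
    ... | no ne = trans (cong (λ t → coeff t w) (sym (dropWord-head v c r')))
                        (trans (coeff-dropWord-other v w r ne) (zero-coeffs w))

≈P⇒lin : (p q : Poly) → p ≈P q → ∀ φ → lin φ p ≡ lin φ q
≈P⇒lin p q e φ = begin
    lin φ p
  ≡⟨ solve 2 (λ a b → a := (a :- b) :+ b) refl (lin φ p) (lin φ q) ⟩
    (lin φ p - lin φ q) + lin φ q
  ≡⟨ cong (_+ lin φ q) (trans (sym (lin-subP φ p q)) (lin-vanishing φ _ (p -P q) ℕₚ.≤-refl difference-zero)) ⟩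
    0ℚ + lin φ q
  ≡⟨ solve 1 (λ a → con 0ℚ :+ a := a) refl (lin φ q) ⟩
    lin φ q
  ∎
  where
    difference-zero : ∀ w → coeff (p -P q) w ≡ 0ℚ
    difference-zero w = begin
        coeff (p -P q) w
      ≡⟨ trans (coeff-lin (p -P q) w) (lin-subP (δ w) p q) ⟩
        lin (δ w) p - lin (δ w) q
      ≡⟨ cong₂ _-_ (trans (sym (coeff-lin p w)) (e w)) (sym (coeff-lin q w)) ⟩
        coeff q w - coeff q w
      ≡⟨ solve 1 (λ a → a :- a := con 0ℚ) refl (coeff q w) ⟩
        0ℚ
      ∎

-- (Tadx φ)(w) = φ(x w) - φ(w x), so that lin φ [x, p] = lin (Tadx φ) p (lin-bracket)
Tadx : (Word → ℚ) → Word → ℚ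
Tadx φ w = φ (x ∷ w) - φ (w ++ x ∷ [])

TadxPow : ℕ → (Word → ℚ) → Word → ℚ
TadxPow zero φ = φ
TadxPow (suc k) φ = TadxPow k (Tadx φ)

module _ (F : Poly) where

  linD : (Word → ℚ) → Poly → ℚ
  linD φ p = lin (λ w → lin φ (DWord F w)) p

  lin-Dder : (φ : Word → ℚ) (p : Poly) → lin φ (Dder F p) ≡ linD φ p
  lin-Dder φ [] = refl
  lin-Dder φ ((c , w) ∷ p) = trans (lin-++ φ (scaleP c (DWord F w)) (Dder F p))
    (cong₂ _+_ (lin-scaleP φ c (DWord F w)) (lin-Dder φ p))

  lin-DWord-cons : (φ : Word → ℚ) (l : Letter) (w : Word) →
    lin φ (DWord F (l ∷ w)) ≡ lin (λ a → φ (a ++ w)) (DLetter F l) + lin (λ b → φ (l ∷ b)) (DWord F w)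
  lin-DWord-cons φ l w = trans (lin-++ φ (DLetter F l *P ((1ℚ , w) ∷ [])) (letter l *P DWord F w))
    (cong₂ _+_ (trans (lin-mulP φ (DLetter F l) ((1ℚ , w) ∷ []))
                      (lin-cong _ _ (DLetter F l) (λ v → lin-single (λ u → φ (v ++ u)) w)))
               (lin-lmul φ l (DWord F w)))

  lin-DWord-++ : (φ : Word → ℚ) (v u : Word) →
    lin φ (DWord F (v ++ u)) ≡ lin (λ a → φ (a ++ u)) (DWord F v) + lin (λ b → φ (v ++ b)) (DWord F u)
  lin-DWord-++ φ [] u = solve 1 (λ a → a := con 0ℚ :+ a) refl (lin φ (DWord F u))
  lin-DWord-++ φ (l ∷ v) u = begin
      lin φ (DWord F (l ∷ (v ++ u)))
    ≡⟨ lin-DWord-cons φ l (v ++ u) ⟩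
      A₁ + lin (λ b → φ (l ∷ b)) (DWord F (v ++ u))
    ≡⟨ cong (A₁ +_) (lin-DWord-++ (λ b → φ (l ∷ b)) v u) ⟩
      A₁ + (B + C)
    ≡⟨ cong (λ z → z + (B + C)) (lin-cong _ _ (DLetter F l) (λ a → cong φ (sym (++-assoc a v u)))) ⟩
      A₂ + (B + C)
    ≡⟨ solve 3 (λ a b c → a :+ (b :+ c) := (a :+ b) :+ c) refl A₂ B C ⟩
      (A₂ + B) + C
    ≡⟨ cong (_+ C) (sym (lin-DWord-cons (λ a → φ (a ++ u)) l v)) ⟩
      lin (λ a → φ (a ++ u)) (DWord F (l ∷ v)) + C
    ∎
    where
      A₁ = lin (λ a → φ (a ++ (v ++ u))) (DLetter F l)
      A₂ = lin (λ a → φ ((a ++ v) ++ u)) (DLetter F l)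
      B = lin (λ a → φ (l ∷ (a ++ u))) (DWord F v)
      C = lin (λ b → φ (l ∷ (v ++ b))) (DWord F u)

  linD-mul : (φ : Word → ℚ) (p q : Poly) →
    linD φ (p *P q) ≡ linD (λ v → lin (λ u → φ (v ++ u)) q) p + lin (λ v → linD (λ u → φ (v ++ u)) q) p
  linD-mul φ p q =
    trans (lin-mulP (λ w → lin φ (DWord F w)) p q)
    (trans (lin-cong _ _ p (λ v → trans (lin-cong _ _ q (λ u → lin-DWord-++ φ v u)) (lin-add _ _ q)))
    (trans (lin-add _ _ p)
      (cong (_+ lin (λ v → linD (λ u → φ (v ++ u)) q) p)
        (lin-cong _ _ p (λ v → lin-swap (λ u a → φ (a ++ u)) q (DWord F v))))))

  -- D_F commutes with ad(x), since D_F(x) = 0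
  linD-adx : (φ : Word → ℚ) (p : Poly) → linD φ (bracket (letter x) p) ≡ linD (Tadx φ) p
  linD-adx φ p = begin
      linD φ (bracket (letter x) p)
    ≡⟨ lin-++ _ (letter x *P p) (negP (p *P letter x)) ⟩
      linD φ (letter x *P p) + lin (λ w → lin φ (DWord F w)) (negP (p *P letter x))
    ≡⟨ cong₂ _+_ (linD-mul φ (letter x) p) (lin-negP _ (p *P letter x)) ⟩
      (linD (λ v → lin (λ u → φ (v ++ u)) p) (letter x) + lin (λ v → linD (λ u → φ (v ++ u)) p) (letter x))
        + - linD φ (p *P letter x)
    ≡⟨ cong₂ (λ a b → (0ℚ + a) + - b) (lin-letter (λ v → linD (λ u → φ (v ++ u)) p) x) (linD-mul φ p (letter x)) ⟩
      (0ℚ + P₁) + - (linD (λ v → lin (λ u → φ (v ++ u)) (letter x)) p + lin (λ v → linD (λ u → φ (v ++ u)) (letter x)) p)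
    ≡⟨ cong₂ (λ a b → (0ℚ + P₁) + - (a + b))
         (lin-cong _ _ p (λ w → lin-cong _ _ (DWord F w) (λ v → lin-letter (λ u → φ (v ++ u)) x)))
         (lin-zero _ p (λ v → refl)) ⟩
      (0ℚ + P₁) + - (P₂ + 0ℚ)
    ≡⟨ solve 2 (λ a b → (con 0ℚ :+ a) :+ :- (b :+ con 0ℚ) := a :- b) refl P₁ P₂ ⟩
      P₁ - P₂
    ≡⟨ sym (trans (lin-cong _ _ p (λ w → lin-sub _ _ (DWord F w))) (lin-sub _ _ p)) ⟩
      linD (Tadx φ) p
    ∎
    where
      P₁ = linD (λ u → φ (x ∷ u)) p
      P₂ = linD (λ v → φ (v ++ x ∷ [])) p

  linD-y : (φ : Word → ℚ) → linD φ (letter y) ≡ lin φ (bracket (letter y) F)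
  linD-y φ = trans (lin-letter (λ w → lin φ (DWord F w)) y)
    (trans (lin-DWord-cons φ y [])
    (trans (solve 1 (λ a → a :+ con 0ℚ := a) refl (lin (λ a → φ (a ++ [])) (bracket (letter y) F)))
      (lin-cong _ _ (bracket (letter y) F) (λ a → cong φ (++-identityʳ a)))))

  linD-adxPow : (k : ℕ) (φ : Word → ℚ) → linD φ (adxPow k) ≡ lin (TadxPow k φ) (bracket (letter y) F)
  linD-adxPow zero φ = linD-y φ
  linD-adxPow (suc k) φ = trans (linD-adx φ (adxPow k)) (linD-adxPow k (Tadx φ))

scaleC : ℚ → CPoly → CPoly
scaleC a = map (λ e → (a * proj₁ e , proj₂ e))

bindC : (CMon → CPoly) → CPoly → CPoly
bindC g [] = []
bindC g ((c , m) ∷ h) = scaleC c (g m) ++ bindC g h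

-- left multiplication by the generator C_{k+1}
prependC : ℕ → CPoly → CPoly
prependC k = map (λ e → (proj₁ e , k ∷ proj₂ e))

mulC : CPoly → CPoly → CPoly
mulC h₁ h₂ = bindC (λ m → map (λ e → (proj₁ e , m ++ proj₂ e)) h₂) h₁

lin-scaleC : (ψ : CMon → ℚ) (a : ℚ) (h : CPoly) → lin ψ (scaleC a h) ≡ a * lin ψ h
lin-scaleC ψ a [] = solve 1 (λ a → con 0ℚ := a :* con 0ℚ) refl a
lin-scaleC ψ a ((c , w) ∷ p) rewrite lin-scaleC ψ a p =
  solve 4 (λ a c f l → a :* c :* f :+ a :* l := a :* (c :* f :+ l)) refl a c (ψ w) (lin ψ p)

lin-bindC : (ψ : CMon → ℚ) (g : CMon → CPoly) (h : CPoly) → lin ψ (bindC g h) ≡ lin (λ m → lin ψ (g m)) h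
lin-bindC ψ g [] = refl
lin-bindC ψ g ((c , m) ∷ h) = trans (lin-++ ψ (scaleC c (g m)) (bindC g h))
  (cong₂ _+_ (lin-scaleC ψ c (g m)) (lin-bindC ψ g h))

lin-prependC : (ψ : CMon → ℚ) (k : ℕ) (h : CPoly) → lin ψ (prependC k h) ≡ lin (λ m → ψ (k ∷ m)) h
lin-prependC ψ k [] = refl
lin-prependC ψ k ((c , m) ∷ h) = cong (c * ψ (k ∷ m) +_) (lin-prependC ψ k h)

lin-mulC : (ψ : CMon → ℚ) (h₁ h₂ : CPoly) → lin ψ (mulC h₁ h₂) ≡ lin (λ m → lin (λ m′ → ψ (m ++ m′)) h₂) h₁
lin-mulC ψ h₁ h₂ = trans (lin-bindC ψ _ h₁) (lin-cong _ _ h₁ (λ m → prefix m h₂))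
  where
    prefix : (m : CMon) (h : CPoly) → lin ψ (map (λ e → (proj₁ e , m ++ proj₂ e)) h) ≡ lin (λ m′ → ψ (m ++ m′)) h
    prefix m [] = refl
    prefix m ((c , m′) ∷ h) = cong (c * ψ (m ++ m′) +_) (prefix m h)

lin-evalC : (φ : Word → ℚ) (h : CPoly) → lin φ (evalC h) ≡ lin (λ m → lin φ (evalMon m)) h
lin-evalC φ [] = refl
lin-evalC φ ((c , m) ∷ h) = trans (lin-++ φ (scaleP c (evalMon m)) (evalC h))
  (cong₂ _+_ (lin-scaleP φ c (evalMon m)) (lin-evalC φ h))

lin-evalC-cong : (φ : Word → ℚ) (h : CPoly) (ψ : CMon → ℚ) → (∀ m → lin φ (evalMon m) ≡ ψ m) →
  lin φ (evalC h) ≡ lin ψ h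
lin-evalC-cong φ h ψ e = trans (lin-evalC φ h) (lin-cong _ _ h e)

lin-evalC-++ : (φ : Word → ℚ) (h₁ h₂ : CPoly) → lin φ (evalC (h₁ ++ h₂)) ≡ lin φ (evalC h₁) + lin φ (evalC h₂)
lin-evalC-++ φ h₁ h₂ = trans (lin-evalC φ (h₁ ++ h₂)) (trans (lin-++ _ h₁ h₂)
  (sym (cong₂ _+_ (lin-evalC φ h₁) (lin-evalC φ h₂))))

lin-evalC-scaleC : (φ : Word → ℚ) (a : ℚ) (h : CPoly) → lin φ (evalC (scaleC a h)) ≡ a * lin φ (evalC h)
lin-evalC-scaleC φ a h = trans (lin-evalC φ (scaleC a h)) (trans (lin-scaleC _ a h) (cong (a *_) (sym (lin-evalC φ h))))

lin-evalC-bindC : (φ : Word → ℚ) (g : CMon → CPoly) (h : CPoly) →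
  lin φ (evalC (bindC g h)) ≡ lin (λ m → lin φ (evalC (g m))) h
lin-evalC-bindC φ g h = trans (lin-evalC φ (bindC g h)) (trans (lin-bindC _ g h)
  (lin-cong _ _ h (λ m → sym (lin-evalC φ (g m)))))

lin-evalC-single : (φ : Word → ℚ) (m : CMon) → lin φ (evalC ((1ℚ , m) ∷ [])) ≡ lin φ (evalMon m)
lin-evalC-single φ m = trans (lin-evalC φ ((1ℚ , m) ∷ [])) (lin-single (λ m → lin φ (evalMon m)) m)

lin-evalMon-++ : (φ : Word → ℚ) (m m′ : CMon) →
  lin φ (evalMon (m ++ m′)) ≡ lin (λ v → lin (λ u → φ (v ++ u)) (evalMon m′)) (evalMon m)
lin-evalMon-++ φ [] m′ = sym (lin-single (λ v → lin (λ u → φ (v ++ u)) (evalMon m′)) [])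
lin-evalMon-++ φ (k ∷ m) m′ = begin
    lin φ (Cgen k *P evalMon (m ++ m′))
  ≡⟨ lin-mulP φ (Cgen k) (evalMon (m ++ m′)) ⟩
    lin (λ v → lin (λ u → φ (v ++ u)) (evalMon (m ++ m′))) (Cgen k)
  ≡⟨ lin-cong _ _ (Cgen k) (λ v → trans (lin-evalMon-++ (λ u → φ (v ++ u)) m m′)
       (lin-cong _ _ (evalMon m) (λ a → lin-cong _ _ (evalMon m′) (λ b → cong φ (sym (++-assoc v a b)))))) ⟩
    lin (λ v → lin (λ a → lin (λ b → φ ((v ++ a) ++ b)) (evalMon m′)) (evalMon m)) (Cgen k)
  ≡⟨ sym (lin-mulP (λ w → lin (λ b → φ (w ++ b)) (evalMon m′)) (Cgen k) (evalMon m)) ⟩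
    lin (λ v → lin (λ u → φ (v ++ u)) (evalMon m′)) (Cgen k *P evalMon m)
  ∎

lin-evalC-mulC : (φ : Word → ℚ) (h₁ h₂ : CPoly) →
  lin φ (evalC (mulC h₁ h₂)) ≡ lin (λ v → lin (λ u → φ (v ++ u)) (evalC h₂)) (evalC h₁)
lin-evalC-mulC φ h₁ h₂ = begin
    lin φ (evalC (mulC h₁ h₂))
  ≡⟨ trans (lin-evalC φ (mulC h₁ h₂)) (lin-mulC _ h₁ h₂) ⟩
    lin (λ m → lin (λ m′ → lin φ (evalMon (m ++ m′))) h₂) h₁
  ≡⟨ lin-cong _ _ h₁ (λ m → lin-cong _ _ h₂ (λ m′ → lin-evalMon-++ φ m m′)) ⟩
    lin (λ m → lin (λ m′ → lin (λ v → lin (λ u → φ (v ++ u)) (evalMon m′)) (evalMon m)) h₂) h₁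
  ≡⟨ lin-cong _ _ h₁ (λ m → lin-swap (λ m′ v → lin (λ u → φ (v ++ u)) (evalMon m′)) h₂ (evalMon m)) ⟩
    lin (λ m → lin (λ v → lin (λ m′ → lin (λ u → φ (v ++ u)) (evalMon m′)) h₂) (evalMon m)) h₁
  ≡⟨ sym (lin-evalC-cong _ h₁ _ (λ m → lin-cong _ _ (evalMon m) (λ v → lin-evalC (λ u → φ (v ++ u)) h₂))) ⟩
    lin (λ v → lin (λ u → φ (v ++ u)) (evalC h₂)) (evalC h₁)
  ∎

lin-evalC-prependC : (φ : Word → ℚ) (k : ℕ) (h : CPoly) →
  lin φ (evalC (prependC k h)) ≡ lin (λ v → lin (λ u → φ (v ++ u)) (evalC h)) (Cgen k)
lin-evalC-prependC φ k h = begin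
    lin φ (evalC (prependC k h))
  ≡⟨ trans (lin-evalC φ (prependC k h)) (lin-prependC _ k h) ⟩
    lin (λ m → lin φ (Cgen k *P evalMon m)) h
  ≡⟨ lin-cong _ _ h (λ m → lin-mulP φ (Cgen k) (evalMon m)) ⟩
    lin (λ m → lin (λ v → lin (λ u → φ (v ++ u)) (evalMon m)) (Cgen k)) h
  ≡⟨ lin-swap (λ m v → lin (λ u → φ (v ++ u)) (evalMon m)) h (Cgen k) ⟩
    lin (λ v → lin (λ m → lin (λ u → φ (v ++ u)) (evalMon m)) h) (Cgen k)
  ≡⟨ lin-cong _ _ (Cgen k) (λ v → sym (lin-evalC (λ u → φ (v ++ u)) h)) ⟩
    lin (λ v → lin (λ u → φ (v ++ u)) (evalC h)) (Cgen k)
  ∎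

-- ad(x)(C_{k+1} m) = C_{k+2} m + C_{k+1} ad(x)(m)
adxMon : CMon → CPoly
adxMon [] = []
adxMon (k ∷ ks) = (1ℚ , suc k ∷ ks) ∷ prependC k (adxMon ks)

adxPowC : ℕ → CPoly → CPoly
adxPowC zero h = h
adxPowC (suc k) h = bindC adxMon (adxPowC k h)

lin-evalC-adxMon : (m : CMon) (φ : Word → ℚ) → lin φ (evalC (adxMon m)) ≡ lin (Tadx φ) (evalMon m)
lin-evalC-adxMon [] φ = solve 1 (λ a → con 0ℚ := con 1ℚ :* (a :- a) :+ con 0ℚ) refl (φ (x ∷ []))
lin-evalC-adxMon (k ∷ ks) φ = begin
    lin φ (evalC (adxMon (k ∷ ks)))
  ≡⟨ lin-++ φ (scaleP 1ℚ (evalMon (suc k ∷ ks))) (evalC (prependC k (adxMon ks))) ⟩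
    lin φ (scaleP 1ℚ (evalMon (suc k ∷ ks))) + lin φ (evalC (prependC k (adxMon ks)))
  ≡⟨ cong₂ _+_ (lin-scaleP φ 1ℚ (evalMon (suc k ∷ ks))) (lin-evalC-prependC φ k (adxMon ks)) ⟩
    1ℚ * lin φ (Cgen (suc k) *P Ks) + lin (λ v → lin (λ u → φ (v ++ u)) (evalC (adxMon ks))) Ck
  ≡⟨ cong₂ (λ a b → 1ℚ * a + b) (trans (lin-mulP φ (Cgen (suc k)) Ks) (lin-bracket ψ x Ck))
       (lin-cong _ _ Ck (λ v → lin-evalC-adxMon ks (λ u → φ (v ++ u)))) ⟩
    1ℚ * lin (Tadx ψ) Ck + lin (λ v → lin (Tadx (λ u → φ (v ++ u))) Ks) Ck
  ≡⟨ trans (cong (_+ lin (λ v → lin (Tadx (λ u → φ (v ++ u))) Ks) Ck) (solve 1 (λ a → con 1ℚ :* a := a) refl (lin (Tadx ψ) Ck)))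
       (sym (lin-add _ _ Ck)) ⟩
    lin (λ v → Tadx ψ v + lin (Tadx (λ u → φ (v ++ u))) Ks) Ck
  ≡⟨ lin-cong _ _ Ck telescope ⟩
    lin (λ v → lin (λ u → Tadx φ (v ++ u)) Ks) Ck
  ≡⟨ sym (lin-mulP (Tadx φ) Ck Ks) ⟩
    lin (Tadx φ) (evalMon (k ∷ ks))
  ∎
  where
    Ck = Cgen k
    Ks = evalMon ks
    ψ : Word → ℚ
    ψ v = lin (λ u → φ (v ++ u)) Ks
    -- ad(x) is a derivation: the middle terms v x Ks cancel
    telescope : ∀ v → Tadx ψ v + lin (Tadx (λ u → φ (v ++ u))) Ks ≡ lin (λ u → Tadx φ (v ++ u)) Ks
    telescope v = begin
        (ψ (x ∷ v) - ψ (v ++ x ∷ [])) + lin (λ u → φ (v ++ x ∷ u) - φ (v ++ (u ++ x ∷ []))) Ks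
      ≡⟨ cong₂ (λ a b → (ψ (x ∷ v) - a) + b)
           (lin-cong _ _ Ks (λ u → cong φ (++-assoc v (x ∷ []) u))) (lin-sub _ _ Ks) ⟩
        (ψ (x ∷ v) - b) + (b - c)
      ≡⟨ solve 3 (λ a b c → (a :- b) :+ (b :- c) := a :- c) refl (ψ (x ∷ v)) b c ⟩
        ψ (x ∷ v) - c
      ≡⟨ cong (λ t → ψ (x ∷ v) - t) (lin-cong _ _ Ks (λ u → cong φ (sym (++-assoc v u (x ∷ []))))) ⟩
        ψ (x ∷ v) - lin (λ u → φ ((v ++ u) ++ x ∷ [])) Ks
      ≡⟨ sym (lin-sub _ _ Ks) ⟩
        lin (λ u → Tadx φ (v ++ u)) Ks
      ∎
      where
        b = lin (λ u → φ (v ++ x ∷ u)) Ks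
        c = lin (λ u → φ (v ++ (u ++ x ∷ []))) Ks

lin-evalC-adxPowC : (k : ℕ) (h : CPoly) (φ : Word → ℚ) → lin φ (evalC (adxPowC k h)) ≡ lin (TadxPow k φ) (evalC h)
lin-evalC-adxPowC zero h φ = refl
lin-evalC-adxPowC (suc k) h φ =
  trans (lin-evalC-bindC φ adxMon (adxPowC k h))
  (trans (lin-cong _ _ (adxPowC k h) (λ m → lin-evalC-adxMon m φ))
  (trans (sym (lin-evalC (Tadx φ) (adxPowC k h))) (lin-evalC-adxPowC k h (Tadx φ))))

C₁ : CPoly
C₁ = (1ℚ , 0 ∷ []) ∷ []

lin-evalC-C₁ : (φ : Word → ℚ) → lin φ (evalC C₁) ≡ φ (y ∷ [])
lin-evalC-C₁ φ = trans (lin-evalC-single φ (0 ∷ []))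
  (trans (lin-lmul φ y ((1ℚ , []) ∷ [])) (lin-single (λ u → φ (y ∷ u)) []))

bracketYC : CPoly → CPoly
bracketYC h = mulC C₁ h ++ scaleC (- 1ℚ) (mulC h C₁)

lin-evalC-bracketYC : (φ : Word → ℚ) (h : CPoly) → lin φ (evalC (bracketYC h)) ≡ lin φ (bracket (letter y) (evalC h))
lin-evalC-bracketYC φ h = begin
    lin φ (evalC (bracketYC h))
  ≡⟨ lin-evalC-++ φ (mulC C₁ h) (scaleC (- 1ℚ) (mulC h C₁)) ⟩
    lin φ (evalC (mulC C₁ h)) + lin φ (evalC (scaleC (- 1ℚ) (mulC h C₁)))
  ≡⟨ cong₂ _+_ (trans (lin-evalC-mulC φ C₁ h) (lin-evalC-C₁ (λ v → lin (λ u → φ (v ++ u)) (evalC h))))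
               (trans (lin-evalC-scaleC φ (- 1ℚ) (mulC h C₁))
                 (cong ((- 1ℚ) *_) (trans (lin-evalC-mulC φ h C₁)
                   (lin-cong _ _ (evalC h) (λ v → lin-evalC-C₁ (λ u → φ (v ++ u))))))) ⟩
    a + (- 1ℚ) * b
  ≡⟨ solve 2 (λ a b → a :+ con (- 1ℚ) :* b := a :- b) refl a b ⟩
    a - b
  ≡⟨ sym (trans (lin-bracket φ y (evalC h)) (lin-sub _ _ (evalC h))) ⟩
    lin φ (bracket (letter y) (evalC h))
  ∎
  where
    a = lin (λ u → φ (y ∷ u)) (evalC h)
    b = lin (λ u → φ (u ++ y ∷ [])) (evalC h)

module _ (f : CPoly) where

  -- D_f on a C-monomial:  D_f(C_{k+1} m) = ad(x)^k [y, f] · m + C_{k+1} D_f(m)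
  DMon : CMon → CPoly
  DMon [] = []
  DMon (k ∷ ks) = mulC (adxPowC k (bracketYC f)) ((1ℚ , ks) ∷ []) ++ prependC k (DMon ks)

  lin-evalC-DMon : (m : CMon) (φ : Word → ℚ) → lin φ (evalC (DMon m)) ≡ linD (evalC f) φ (evalMon m)
  lin-evalC-DMon [] φ = solve 0 (con 0ℚ := con 1ℚ :* con 0ℚ :+ con 0ℚ) refl
  lin-evalC-DMon (k ∷ ks) φ = begin
      lin φ (evalC (DMon (k ∷ ks)))
    ≡⟨ lin-evalC-++ φ (mulC (adxPowC k (bracketYC f)) ((1ℚ , ks) ∷ [])) (prependC k (DMon ks)) ⟩
      lin φ (evalC (mulC (adxPowC k (bracketYC f)) ((1ℚ , ks) ∷ []))) + lin φ (evalC (prependC k (DMon ks)))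
    ≡⟨ cong₂ _+_
         (trans (lin-evalC-mulC φ (adxPowC k (bracketYC f)) ((1ℚ , ks) ∷ []))
           (trans (lin-cong _ ψ (evalC (adxPowC k (bracketYC f))) (λ v → lin-evalC-single (λ u → φ (v ++ u)) ks))
           (trans (lin-evalC-adxPowC k (bracketYC f) ψ) (lin-evalC-bracketYC (TadxPow k ψ) f))))
         (trans (lin-evalC-prependC φ k (DMon ks))
           (lin-cong _ _ (Cgen k) (λ v → lin-evalC-DMon ks (λ u → φ (v ++ u))))) ⟩
      lin (TadxPow k ψ) (bracket (letter y) (evalC f)) + lin (λ v → linD (evalC f) (λ u → φ (v ++ u)) Ks) (Cgen k)
    ≡⟨ cong (_+ lin (λ v → linD (evalC f) (λ u → φ (v ++ u)) Ks) (Cgen k)) (sym (linD-adxPow (evalC f) k ψ)) ⟩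
      linD (evalC f) ψ (Cgen k) + lin (λ v → linD (evalC f) (λ u → φ (v ++ u)) Ks) (Cgen k)
    ≡⟨ sym (linD-mul (evalC f) φ (Cgen k) Ks) ⟩
      linD (evalC f) φ (evalMon (k ∷ ks))
    ∎
    where
      Ks = evalMon ks
      ψ : Word → ℚ
      ψ v = lin (λ u → φ (v ++ u)) Ks

  Dder-inC : (g : CPoly) → evalC (bindC DMon g) ≈P Dder (evalC f) (evalC g)
  Dder-inC g = lin⇒≈P (evalC (bindC DMon g)) (Dder (evalC f) (evalC g)) λ φ → begin
      lin φ (evalC (bindC DMon g))
    ≡⟨ lin-evalC-bindC φ DMon g ⟩
      lin (λ m → lin φ (evalC (DMon m))) g
    ≡⟨ sym (lin-evalC-cong (λ w → lin φ (DWord (evalC f) w)) g (λ m → lin φ (evalC (DMon m))) (λ m → sym (lin-evalC-DMon m φ))) ⟩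
      linD (evalC f) φ (evalC g)
    ≡⟨ sym (lin-Dder (evalC f) φ (evalC g)) ⟩
      lin φ (Dder (evalC f) (evalC g))
    ∎

mutual
  -- levels (u₁,…,u_r) = (z₀,…,z_r) with z_i = -(u_{i+1}+⋯+u_r)
  levels : List ℚ → List ℚ
  levels us = (- sumℚ us) ∷ levelsTail us

  levelsTail : List ℚ → List ℚ
  levelsTail [] = []
  levelsTail (u ∷ us) = levels us

exhausted : List ℚ → ℚ
exhausted [] = 1ℚ
exhausted (_ ∷ _) = 0ℚ

-- weight (z₀,…,z_r) (x^{e₀} y x^{e₁} ⋯ y x^{e_r}) = z₀^{e₀} ⋯ z_r^{e_r};
-- words with a different number of y's have weight 0
weight : List ℚ → Word → ℚ
weight [] w = 0ℚ
weight (z ∷ zs) [] = exhausted zs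
weight (z ∷ zs) (x ∷ w) = z * weight (z ∷ zs) w
weight (z ∷ zs) (y ∷ w) = weight zs w

headOr0 : List ℚ → ℚ
headOr0 [] = 0ℚ
headOr0 (z ∷ _) = z

weight-split₀ : (a r : Word) (zs : List ℚ) → countY a ≡ 0 → weight zs (a ++ r) ≡ weight (headOr0 zs ∷ []) a * weight zs r
weight-split₀ [] r zs e = solve 1 (λ a → a := con 1ℚ :* a) refl (weight zs r)
weight-split₀ (x ∷ a) r [] e = solve 1 (λ a → con 0ℚ := a :* con 0ℚ) refl (weight (0ℚ ∷ []) (x ∷ a))
weight-split₀ (x ∷ a) r (z ∷ zs) e rewrite weight-split₀ a r (z ∷ zs) e =
  solve 3 (λ z p q → z :* (p :* q) := z :* p :* q) refl z (weight (z ∷ []) a) (weight (z ∷ zs) r)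

weight-split₁ : (a r : Word) (z₀ : ℚ) (zs : List ℚ) → countY a ≡ 1 →
  weight (z₀ ∷ zs) (a ++ r) ≡ weight (z₀ ∷ headOr0 zs ∷ []) a * weight zs r
weight-split₁ [] r z₀ zs ()
weight-split₁ (x ∷ a) r z₀ zs e rewrite weight-split₁ a r z₀ zs e =
  solve 3 (λ z p q → z :* (p :* q) := z :* p :* q) refl z₀ (weight (z₀ ∷ headOr0 zs ∷ []) a) (weight zs r)
weight-split₁ (y ∷ a) r z₀ zs e = weight-split₀ a r zs (cong ℕ.pred e)

OfDepth : ℕ → Poly → Set
OfDepth n p = All (λ e → countY (proj₂ e) ≡ n) p

countY-++ : (v u : Word) → countY (v ++ u) ≡ countY v ℕ.+ countY u
countY-++ [] u = refl
countY-++ (x ∷ v) u = countY-++ v u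
countY-++ (y ∷ v) u = cong suc (countY-++ v u)

OfDepth-++ : (n : ℕ) (p q : Poly) → OfDepth n p → OfDepth n q → OfDepth n (p ++ q)
OfDepth-++ n [] q [] dq = dq
OfDepth-++ n (e ∷ p) q (d ∷ dp) dq = d ∷ OfDepth-++ n p q dp dq

OfDepth-mul : (a b : ℕ) (p q : Poly) → OfDepth a p → OfDepth b q → OfDepth (a ℕ.+ b) (p *P q)
OfDepth-mul a b [] q [] dq = []
OfDepth-mul a b ((c , v) ∷ p) q (dv ∷ dp) dq =
  OfDepth-++ (a ℕ.+ b) _ (p *P q) (prefix q dq) (OfDepth-mul a b p q dp dq)
  where
    prefix : (q : Poly) → OfDepth b q → OfDepth (a ℕ.+ b) (map (λ e → (c * proj₁ e , v ++ proj₂ e)) q)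
    prefix [] [] = []
    prefix ((d , w) ∷ q) (dw ∷ dq) = trans (countY-++ v w) (cong₂ ℕ._+_ dv dw) ∷ prefix q dq

OfDepth-adxPow : (k : ℕ) → OfDepth 1 (adxPow k)
OfDepth-adxPow zero = refl ∷ []
OfDepth-adxPow (suc k) = OfDepth-++ 1 (letter x *P adxPow k) (negP (adxPow k *P letter x))
  (OfDepth-mul 0 1 (letter x) (adxPow k) (refl ∷ []) (OfDepth-adxPow k))
  (scaled (adxPow k *P letter x) (OfDepth-mul 1 0 (adxPow k) (letter x) (OfDepth-adxPow k) (refl ∷ [])))
  where
    scaled : (p : Poly) → OfDepth 1 p → OfDepth 1 (negP p)
    scaled [] [] = []
    scaled (e ∷ p) (d ∷ dp) = d ∷ scaled p dp

lin-congᴰ : (n : ℕ) (φ ψ : Word → ℚ) (p : Poly) → OfDepth n p → (∀ w → countY w ≡ n → φ w ≡ ψ w) →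
  lin φ p ≡ lin ψ p
lin-congᴰ n φ ψ p dp agree = lin-congᴬ φ ψ p (pointwise p dp)
  where
    pointwise : (p : Poly) → OfDepth n p → All (λ e → φ (proj₂ e) ≡ ψ (proj₂ e)) p
    pointwise [] [] = []
    pointwise ((c , w) ∷ p) (d ∷ dp) = agree w d ∷ pointwise p dp

lin-weight-adxPow : (k : ℕ) (z₀ z₁ : ℚ) → lin (weight (z₀ ∷ z₁ ∷ [])) (adxPow k) ≡ powℚ (z₀ - z₁) k
lin-weight-adxPow zero z₀ z₁ = lin-letter (weight (z₀ ∷ z₁ ∷ [])) y
lin-weight-adxPow (suc k) z₀ z₁ = begin
    lin (weight zz) (bracket (letter x) (adxPow k))
  ≡⟨ lin-bracket (weight zz) x (adxPow k) ⟩
    lin (λ u → weight zz (x ∷ u) - weight zz (u ++ x ∷ [])) (adxPow k)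
  ≡⟨ lin-congᴰ 1 _ _ (adxPow k) (OfDepth-adxPow k)
       (λ u e → cong (λ t → z₀ * weight zz u - t) (weight-split₁ u (x ∷ []) z₀ (z₁ ∷ []) e)) ⟩
    lin (λ u → z₀ * weight zz u - weight zz u * (z₁ * 1ℚ)) (adxPow k)
  ≡⟨ lin-cong _ _ (adxPow k) (λ u → solve 3 (λ a b c → b :* c :- c :* (a :* con 1ℚ) := (b :- a) :* c) refl z₁ z₀ (weight zz u)) ⟩
    lin (λ u → (z₀ - z₁) * weight zz u) (adxPow k)
  ≡⟨ trans (lin-scale (weight zz) (z₀ - z₁) (adxPow k)) (cong ((z₀ - z₁) *_) (lin-weight-adxPow k z₀ z₁)) ⟩
    powℚ (z₀ - z₁) (suc k)
  ∎
  where
    zz = z₀ ∷ z₁ ∷ []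

monWeight : CMon → List ℚ → Word → ℚ
monWeight m ws W = lin (λ v → weight (levels ws) (v ++ W)) (evalMon m)

monWeight-nil : (ws : List ℚ) (W : Word) → monWeight [] ws W ≡ weight (levels ws) W
monWeight-nil ws W = lin-single (λ v → weight (levels ws) (v ++ W)) []

monWeight-cons : (k : ℕ) (ks : CMon) (u : ℚ) (ws : List ℚ) (W : Word) →
  monWeight (k ∷ ks) (u ∷ ws) W ≡ powℚ (- u) k * monWeight ks ws W
monWeight-cons k ks u ws W = begin
    lin φ (Cgen k *P evalMon ks)
  ≡⟨ lin-mulP φ (Cgen k) (evalMon ks) ⟩
    lin (λ a → lin (λ b → φ (a ++ b)) (evalMon ks)) (Cgen k)
  ≡⟨ lin-congᴰ 1 _ _ (Cgen k) (OfDepth-adxPow k) (λ a e →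
       trans (lin-cong _ _ (evalMon ks) (λ b → trans (cong (weight (levels (u ∷ ws))) (++-assoc a b W))
                                               (weight-split₁ a (b ++ W) z₀ (levels ws) e)))
             (lin-scale (λ b → weight (levels ws) (b ++ W)) (weight zz a) (evalMon ks))) ⟩
    lin (λ a → weight zz a * monWeight ks ws W) (Cgen k)
  ≡⟨ lin-scaleʳ (weight zz) (monWeight ks ws W) (Cgen k) ⟩
    lin (weight zz) (Cgen k) * monWeight ks ws W
  ≡⟨ cong (_* monWeight ks ws W) (trans (lin-weight-adxPow k z₀ (- sumℚ ws))
       (cong (λ t → powℚ t k) (solve 2 (λ u s → :- (u :+ s) :- :- s := :- u) refl u (sumℚ ws)))) ⟩
    powℚ (- u) k * monWeight ks ws W
  ∎
  where
    φ = λ v → weight (levels (u ∷ ws)) (v ++ W)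
    z₀ = - sumℚ (u ∷ ws)
    zz = z₀ ∷ (- sumℚ ws) ∷ []

monWeight-exhausted : (k : ℕ) (ks : CMon) (W : Word) → monWeight (k ∷ ks) [] W ≡ 0ℚ
monWeight-exhausted k ks W =
  trans (lin-mulP φ (Cgen k) (evalMon ks))
  (trans (lin-congᴰ 1 _ (λ _ → 0ℚ) (Cgen k) (OfDepth-adxPow k) (λ a e →
     lin-zero _ (evalMon ks) (λ b → trans (cong (weight (levels [])) (++-assoc a b W))
       (trans (weight-split₁ a (b ++ W) (- 0ℚ) [] e)
         (solve 1 (λ t → t :* con 0ℚ := con 0ℚ) refl (weight (- 0ℚ ∷ 0ℚ ∷ []) a))))))
    (lin-zero _ (Cgen k) (λ _ → refl)))
  where
    φ = λ v → weight (levels []) (v ++ W)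

monMould : CMon → Mould
monMould m us = lin (weight (levels us)) (evalMon m)

monMould-monWeight : (m : CMon) (us : List ℚ) → monMould m us ≡ monWeight m us []
monMould-monWeight m us = lin-cong _ _ (evalMon m) (λ v → cong (weight (levels us)) (sym (++-identityʳ v)))

monMould-cons : (k : ℕ) (ks : CMon) (u : ℚ) (b : List ℚ) → monMould (k ∷ ks) (u ∷ b) ≡ powℚ (- u) k * monMould ks b
monMould-cons k ks u b =
  trans (monMould-monWeight (k ∷ ks) (u ∷ b))
  (trans (monWeight-cons k ks u b []) (cong (powℚ (- u) k *_) (sym (monMould-monWeight ks b))))

monMould-depth : (m : CMon) (b : List ℚ) → ¬ (length b ≡ length m) → monMould m b ≡ 0ℚ
monMould-depth [] [] ne = ⊥-elim (ne refl)
monMould-depth [] (u ∷ b) ne = solve 0 (con 1ℚ :* con 0ℚ :+ con 0ℚ := con 0ℚ) refl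
monMould-depth (k ∷ ks) [] ne = trans (monMould-monWeight (k ∷ ks) []) (monWeight-exhausted k ks [])
monMould-depth (k ∷ ks) (u ∷ b) ne = trans (monMould-cons k ks u b)
  (trans (cong (powℚ (- u) k *_) (monMould-depth ks b (λ e → ne (cong suc e))))
    (solve 1 (λ p → p :* con 0ℚ := con 0ℚ) refl (powℚ (- u) k)))

sgn-+ : (a b : ℕ) → sgn (a ℕ.+ b) ≡ sgn a * sgn b
sgn-+ zero b = solve 1 (λ s → s := con 1ℚ :* s) refl (sgn b)
sgn-+ (suc a) b rewrite sgn-+ a b = solve 2 (λ s t → :- (s :* t) := (:- s) :* t) refl (sgn a) (sgn b)

pow-neg : (u : ℚ) (k : ℕ) → powℚ (- u) k ≡ sgn k * powℚ u k
pow-neg u zero = solve 0 (con 1ℚ := con 1ℚ :* con 1ℚ) refl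
pow-neg u (suc k) rewrite pow-neg u k =
  solve 3 (λ u s p → (:- u) :* (s :* p) := (:- s) :* (u :* p)) refl u (sgn k) (powℚ u k)

sgn-cons : (k : ℕ) (ks : CMon) → sgn (length (k ∷ ks) ℕ.+ degMon (k ∷ ks)) ≡ sgn k * sgn (length ks ℕ.+ degMon ks)
sgn-cons k ks = begin
    sgn (suc (length ks) ℕ.+ (suc k ℕ.+ degMon ks))
  ≡⟨ cong sgn (shuffle (length ks) k (degMon ks)) ⟩
    - - sgn (k ℕ.+ (length ks ℕ.+ degMon ks))
  ≡⟨ solve 1 (λ s → :- (:- s) := s) refl (sgn (k ℕ.+ (length ks ℕ.+ degMon ks))) ⟩
    sgn (k ℕ.+ (length ks ℕ.+ degMon ks))
  ≡⟨ sgn-+ k (length ks ℕ.+ degMon ks) ⟩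
    sgn k * sgn (length ks ℕ.+ degMon ks)
  ∎
  where
    shuffle : (a k b : ℕ) → suc a ℕ.+ (suc k ℕ.+ b) ≡ suc (suc (k ℕ.+ (a ℕ.+ b)))
    shuffle a k b = cong suc (trans (ℕₚ.+-suc a (k ℕ.+ b))
      (cong suc (trans (sym (ℕₚ.+-assoc a k b)) (trans (cong (ℕ._+ b) (ℕₚ.+-comm a k)) (ℕₚ.+-assoc k a b)))))

monMould-ma : (m : CMon) (us : List ℚ) → monMould m us ≡ sgn (length m ℕ.+ degMon m) * monVal m us
monMould-ma [] [] = solve 0 (con 1ℚ :* con 1ℚ :+ con 0ℚ := con 1ℚ :* con 1ℚ) refl
monMould-ma [] (u ∷ us) = solve 0 (con 1ℚ :* con 0ℚ :+ con 0ℚ := con 1ℚ :* con 0ℚ) refl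
monMould-ma (k ∷ ks) [] =
  trans (monMould-depth (k ∷ ks) [] (λ ()))
        (solve 1 (λ s → con 0ℚ := s :* con 0ℚ) refl (sgn (length (k ∷ ks) ℕ.+ degMon (k ∷ ks))))
monMould-ma (k ∷ ks) (u ∷ ws) = begin
    monMould (k ∷ ks) (u ∷ ws)
  ≡⟨ monMould-cons k ks u ws ⟩
    powℚ (- u) k * monMould ks ws
  ≡⟨ cong₂ _*_ (pow-neg u k) (monMould-ma ks ws) ⟩
    (sgn k * powℚ u k) * (sgn (length ks ℕ.+ degMon ks) * monVal ks ws)
  ≡⟨ solve 4 (λ a p b m → (a :* p) :* (b :* m) := (a :* b) :* (p :* m))
       refl (sgn k) (powℚ u k) (sgn (length ks ℕ.+ degMon ks)) (monVal ks ws) ⟩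
    (sgn k * sgn (length ks ℕ.+ degMon ks)) * (powℚ u k * monVal ks ws)
  ≡⟨ cong (_* (powℚ u k * monVal ks ws)) (sym (sgn-cons k ks)) ⟩
    sgn (length (k ∷ ks) ℕ.+ degMon (k ∷ ks)) * monVal (k ∷ ks) (u ∷ ws)
  ∎

ma-weight : (h : CPoly) (us : List ℚ) → ma h us ≡ lin (weight (levels us)) (evalC h)
ma-weight h us = trans (termwise h) (sym (lin-evalC (weight (levels us)) h))
  where
    termwise : (h : CPoly) → ma h us ≡ lin (λ m → monMould m us) h
    termwise [] = refl
    termwise ((c , m) ∷ h) = cong₂ _+_
      (trans (solve 3 (λ s c v → s :* (c :* v) := c :* (s :* v)) refl (sgn (length m ℕ.+ degMon m)) c (monVal m us))
        (cong (c *_) (sym (monMould-ma m us))))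
      (termwise h)

-- lin φ (D_F w) = lin (DWordᵀ φ w) F: each letter y of w = a y c contributes
-- φ(a y v c) - φ(a v y c) for the term v of F.
DWordᵀ : (Word → ℚ) → Word → Word → ℚ
DWordᵀ φ [] v = 0ℚ
DWordᵀ φ (x ∷ w) v = DWordᵀ (λ b → φ (x ∷ b)) w v
DWordᵀ φ (y ∷ w) v = (φ (y ∷ (v ++ w)) - φ (v ++ y ∷ w)) + DWordᵀ (λ b → φ (y ∷ b)) w v

lin-DWord : (F : Poly) (φ : Word → ℚ) (w : Word) → lin φ (DWord F w) ≡ lin (DWordᵀ φ w) F
lin-DWord F φ [] = sym (lin-zero _ F (λ _ → refl))
lin-DWord F φ (x ∷ w) = trans (lin-DWord-cons F φ x w)
  (trans (solve 1 (λ a → con 0ℚ :+ a := a) refl (lin (λ b → φ (x ∷ b)) (DWord F w)))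
    (lin-DWord F (λ b → φ (x ∷ b)) w))
lin-DWord F φ (y ∷ w) = begin
    lin φ (DWord F (y ∷ w))
  ≡⟨ lin-DWord-cons F φ y w ⟩
    lin (λ a → φ (a ++ w)) (bracket (letter y) F) + lin (λ b → φ (y ∷ b)) (DWord F w)
  ≡⟨ cong₂ _+_ (lin-bracket (λ a → φ (a ++ w)) y F) (lin-DWord F (λ b → φ (y ∷ b)) w) ⟩
    lin (λ u → φ (y ∷ (u ++ w)) - φ ((u ++ y ∷ []) ++ w)) F + lin (DWordᵀ (λ b → φ (y ∷ b)) w) F
  ≡⟨ cong (_+ lin (DWordᵀ (λ b → φ (y ∷ b)) w) F)
       (lin-cong _ _ F (λ u → cong (λ t → φ (y ∷ (u ++ w)) - φ t) (++-assoc u (y ∷ []) w))) ⟩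
    lin (λ u → φ (y ∷ (u ++ w)) - φ (u ++ y ∷ w)) F + lin (DWordᵀ (λ b → φ (y ∷ b)) w) F
  ≡⟨ sym (lin-add _ _ F) ⟩
    lin (DWordᵀ φ (y ∷ w)) F
  ∎

DWordᵀ-scale : (c : ℚ) (φ : Word → ℚ) (w v : Word) → DWordᵀ (λ b → c * φ b) w v ≡ c * DWordᵀ φ w v
DWordᵀ-scale c φ [] v = solve 1 (λ c → con 0ℚ := c :* con 0ℚ) refl c
DWordᵀ-scale c φ (x ∷ w) v = DWordᵀ-scale c (λ b → φ (x ∷ b)) w v
DWordᵀ-scale c φ (y ∷ w) v rewrite DWordᵀ-scale c (λ b → φ (y ∷ b)) w v =
  solve 4 (λ c a b o → (c :* a :- c :* b) :+ c :* o := c :* ((a :- b) :+ o))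
    refl c (φ (y ∷ (v ++ w))) (φ (v ++ y ∷ w)) (DWordᵀ (λ b → φ (y ∷ b)) w v)

DWordᵀ-zero : (φ : Word → ℚ) (w v : Word) → (∀ b → φ b ≡ 0ℚ) → DWordᵀ φ w v ≡ 0ℚ
DWordᵀ-zero φ [] v z = refl
DWordᵀ-zero φ (x ∷ w) v z = DWordᵀ-zero (λ b → φ (x ∷ b)) w v (λ b → z (x ∷ b))
DWordᵀ-zero φ (y ∷ w) v z
  rewrite z (y ∷ (v ++ w)) | z (v ++ y ∷ w) | DWordᵀ-zero (λ b → φ (y ∷ b)) w v (λ b → z (y ∷ b)) = refl

module _ {T : Set} where

  sum-cong : (f g : T → ℚ) (l : List T) → (∀ t → f t ≡ g t) → sumℚ (map f l) ≡ sumℚ (map g l)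
  sum-cong f g [] e = refl
  sum-cong f g (t ∷ l) e = cong₂ _+_ (e t) (sum-cong f g l e)

  sum-congᴬ : (P : T → Set) (f g : T → ℚ) (l : List T) → All P l → (∀ t → P t → f t ≡ g t) →
    sumℚ (map f l) ≡ sumℚ (map g l)
  sum-congᴬ P f g [] [] e = refl
  sum-congᴬ P f g (t ∷ l) (p ∷ ps) e = cong₂ _+_ (e t p) (sum-congᴬ P f g l ps e)

  sum-zero : (f : T → ℚ) (l : List T) → (∀ t → f t ≡ 0ℚ) → sumℚ (map f l) ≡ 0ℚ
  sum-zero f [] e = refl
  sum-zero f (t ∷ l) e rewrite e t | sum-zero f l e = refl

  sum-add : (f g : T → ℚ) (l : List T) → sumℚ (map (λ t → f t + g t) l) ≡ sumℚ (map f l) + sumℚ (map g l)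
  sum-add f g [] = refl
  sum-add f g (t ∷ l) rewrite sum-add f g l =
    solve 4 (λ a b s r → (a :+ b) :+ (s :+ r) := (a :+ s) :+ (b :+ r)) refl (f t) (g t) (sumℚ (map f l)) (sumℚ (map g l))

  sum-scale : (k : ℚ) (f : T → ℚ) (l : List T) → sumℚ (map (λ t → k * f t) l) ≡ k * sumℚ (map f l)
  sum-scale k f [] = solve 1 (λ k → con 0ℚ := k :* con 0ℚ) refl k
  sum-scale k f (t ∷ l) rewrite sum-scale k f l =
    solve 3 (λ k a s → k :* a :+ k :* s := k :* (a :+ s)) refl k (f t) (sumℚ (map f l))

  sum-++ : (f : T → ℚ) (l₁ l₂ : List T) → sumℚ (map f (l₁ ++ l₂)) ≡ sumℚ (map f l₁) + sumℚ (map f l₂)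
  sum-++ f [] l₂ = solve 1 (λ a → a := con 0ℚ :+ a) refl (sumℚ (map f l₂))
  sum-++ f (t ∷ l₁) l₂ rewrite sum-++ f l₁ l₂ =
    solve 3 (λ a b c → a :+ (b :+ c) := (a :+ b) :+ c) refl (f t) (sumℚ (map f l₁)) (sumℚ (map f l₂))

  sum-lin-swap : {X : Set} (K : X → T → ℚ) (G : List (ℚ × X)) (l : List T) →
    sumℚ (map (λ t → lin (λ w → K w t) G) l) ≡ lin (λ w → sumℚ (map (K w) l)) G
  sum-lin-swap K G [] = sym (lin-zero _ G (λ _ → refl))
  sum-lin-swap K G (t ∷ l) rewrite sum-lin-swap K G l = sym (lin-add _ _ G)

sum-map-map : {T U : Set} (f : U → ℚ) (g : T → U) (l : List T) → sumℚ (map f (map g l)) ≡ sumℚ (map (λ t → f (g t)) l)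
sum-map-map f g [] = refl
sum-map-map f g (t ∷ l) = cong (f (g t) +_) (sum-map-map f g l)

sumℚ-++ : (a b : List ℚ) → sumℚ (a ++ b) ≡ sumℚ a + sumℚ b
sumℚ-++ [] b = solve 1 (λ a → a := con 0ℚ :+ a) refl (sumℚ b)
sumℚ-++ (u ∷ a) b rewrite sumℚ-++ a b = solve 3 (λ a b c → a :+ (b :+ c) := (a :+ b) :+ c) refl u (sumℚ a) (sumℚ b)

Triple : Set
Triple = List ℚ × List ℚ × List ℚ

flatten : Triple → List ℚ
flatten (a , b , c) = a ++ b ++ c

termLeft termRight : Mould → Mould → Triple → ℚ
termLeft A B t = termL A B (proj₁ t) (proj₁ (proj₂ t)) (proj₂ (proj₂ t))
termRight A B t = termR A B (proj₁ t) (proj₁ (proj₂ t)) (proj₂ (proj₂ t))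

aritLeft aritRight : Mould → Mould → List ℚ → ℚ
aritLeft B A w = sumℚ (map (termLeft A B) (splits3 w))
aritRight B A w = sumℚ (map (termRight A B) (splits3 w))

-- Every term of arit, as a function of the two moulds, is either zero or a
-- product A(P) B(Q) with P nonempty and of total sum that of a b c.
data Shape (T : Mould → Mould → ℚ) (total : ℚ) : Set where
  vanishes : (∀ A B → T A B ≡ 0ℚ) → Shape T total
  product : (p : ℚ) (ps Q : List ℚ) → (∀ A B → T A B ≡ A (p ∷ ps) * B Q) → sumℚ (p ∷ ps) ≡ total → Shape T total

sum-addLast : (s u : ℚ) (as : List ℚ) → sumℚ (addLast s (u ∷ as)) ≡ sumℚ (u ∷ as) + s
sum-addLast s u [] = solve 2 (λ u s → (u :+ s) :+ con 0ℚ := (u :+ con 0ℚ) :+ s) refl u s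
sum-addLast s u (v ∷ as) rewrite sum-addLast s v as =
  solve 3 (λ u a s → u :+ (a :+ s) := (u :+ a) :+ s) refl u (sumℚ (v ∷ as)) s

sum-mergeLeft : (a b : List ℚ) (c : ℚ) (cs : List ℚ) →
  sumℚ (a ++ ((sumℚ b + c) ∷ cs)) ≡ sumℚ (a ++ b ++ c ∷ cs)
sum-mergeLeft a b c cs rewrite sumℚ-++ a ((sumℚ b + c) ∷ cs) | sumℚ-++ a (b ++ c ∷ cs) | sumℚ-++ b (c ∷ cs) =
  solve 4 (λ sa sb c sc → sa :+ ((sb :+ c) :+ sc) := sa :+ (sb :+ (c :+ sc))) refl (sumℚ a) (sumℚ b) c (sumℚ cs)

sum-mergeRight : (u : ℚ) (as b c : List ℚ) →
  sumℚ (addLast (sumℚ b) (u ∷ as) ++ c) ≡ sumℚ ((u ∷ as) ++ b ++ c)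
sum-mergeRight u as b c
  rewrite sumℚ-++ (addLast (sumℚ b) (u ∷ as)) c | sum-addLast (sumℚ b) u as
        | sumℚ-++ (u ∷ as) (b ++ c) | sumℚ-++ b c =
  solve 3 (λ sa sb sc → (sa :+ sb) :+ sc := sa :+ (sb :+ sc)) refl (sumℚ (u ∷ as)) (sumℚ b) (sumℚ c)

termLeft-shape : (t : Triple) → Shape (λ A B → termLeft A B t) (sumℚ (flatten t))
termLeft-shape (a , [] , c) = vanishes (λ _ _ → refl)
termLeft-shape (a , b ∷ bs , []) = vanishes (λ _ _ → refl)
termLeft-shape ([] , b ∷ bs , c ∷ cs) =
  product (sumℚ (b ∷ bs) + c) cs (b ∷ bs) (λ _ _ → refl) (sum-mergeLeft [] (b ∷ bs) c cs)
termLeft-shape (a ∷ as , b ∷ bs , c ∷ cs) =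
  product a (as ++ ((sumℚ (b ∷ bs) + c) ∷ cs)) (b ∷ bs) (λ _ _ → refl) (sum-mergeLeft (a ∷ as) (b ∷ bs) c cs)

termRight-shape : (t : Triple) → Shape (λ A B → termRight A B t) (sumℚ (flatten t))
termRight-shape ([] , b , c) = vanishes (λ _ _ → refl)
termRight-shape (a ∷ as , [] , c) = vanishes (λ _ _ → refl)
termRight-shape (a ∷ [] , b ∷ bs , c) =
  product (a + sumℚ (b ∷ bs)) c (b ∷ bs) (λ _ _ → refl) (sum-mergeRight a [] (b ∷ bs) c)
termRight-shape (a ∷ a′ ∷ as , b ∷ bs , c) =
  product a (addLast (sumℚ (b ∷ bs)) (a′ ∷ as) ++ c) (b ∷ bs) (λ _ _ → refl) (sum-mergeRight a (a′ ∷ as) (b ∷ bs) c)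

arit-cong : (B B′ A A′ : Mould) (us : List ℚ) → (∀ vs → B vs ≡ B′ vs) → (∀ vs → A vs ≡ A′ vs) →
  arit B A us ≡ arit B′ A′ us
arit-cong B B′ A A′ us eB eA =
  cong₂ _-_ (sum-cong _ _ (splits3 us) (λ t → termwise (termLeft-shape t)))
            (sum-cong _ _ (splits3 us) (λ t → termwise (termRight-shape t)))
  where
    termwise : ∀ {T total} → Shape T total → T A B ≡ T A′ B′
    termwise (vanishes z) = trans (z A B) (sym (z A′ B′))
    termwise (product p ps Q e _) = trans (e A B) (trans (cong₂ _*_ (eA (p ∷ ps)) (eB Q)) (sym (e A′ B′)))

arit-linˡ : {X : Set} (B : Mould) (K : X → Mould) (G : List (ℚ × X)) (us : List ℚ) →
  arit B (λ vs → lin (λ w → K w vs) G) us ≡ lin (λ w → arit B (K w) us) G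
arit-linˡ B K G us = begin
    aritLeft B A us - aritRight B A us
  ≡⟨ cong₂ _-_ (trans (sum-cong _ _ (splits3 us) (λ t → termwise (termLeft-shape t))) (sum-lin-swap _ G (splits3 us)))
               (trans (sum-cong _ _ (splits3 us) (λ t → termwise (termRight-shape t))) (sum-lin-swap _ G (splits3 us))) ⟩
    lin (λ w → aritLeft B (K w) us) G - lin (λ w → aritRight B (K w) us) G
  ≡⟨ sym (lin-sub _ _ G) ⟩
    lin (λ w → arit B (K w) us) G
  ∎
  where
    A : Mould
    A vs = lin (λ w → K w vs) G
    termwise : ∀ {T total} → Shape T total → T A B ≡ lin (λ w → T (K w) B) G
    termwise (vanishes z) = trans (z A B) (sym (lin-zero _ G (λ w → z (K w) B)))
    termwise (product p ps Q e _) =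
      trans (e A B) (trans (sym (lin-scaleʳ (λ w → K w (p ∷ ps)) (B Q) G)) (lin-cong _ _ G (λ w → sym (e (K w) B))))

arit-linʳ : {X : Set} (K : X → Mould) (A : Mould) (G : List (ℚ × X)) (us : List ℚ) →
  arit (λ vs → lin (λ w → K w vs) G) A us ≡ lin (λ w → arit (K w) A us) G
arit-linʳ K A G us = begin
    aritLeft B A us - aritRight B A us
  ≡⟨ cong₂ _-_ (trans (sum-cong _ _ (splits3 us) (λ t → termwise (termLeft-shape t))) (sum-lin-swap _ G (splits3 us)))
               (trans (sum-cong _ _ (splits3 us) (λ t → termwise (termRight-shape t))) (sum-lin-swap _ G (splits3 us))) ⟩
    lin (λ w → aritLeft (K w) A us) G - lin (λ w → aritRight (K w) A us) G
  ≡⟨ sym (lin-sub _ _ G) ⟩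
    lin (λ w → arit (K w) A us) G
  ∎
  where
    B : Mould
    B vs = lin (λ w → K w vs) G
    termwise : ∀ {T total} → Shape T total → T A B ≡ lin (λ w → T A (K w)) G
    termwise (vanishes z) = trans (z A B) (sym (lin-zero _ G (λ w → z A (K w))))
    termwise (product p ps Q e _) =
      trans (e A B) (trans (sym (lin-scale (λ w → K w Q) (A (p ∷ ps)) G)) (lin-cong _ _ G (λ w → sym (e A (K w)))))

arit-vanish : (B A : Mould) (us : List ℚ) → (∀ v vs → A (v ∷ vs) ≡ 0ℚ) → arit B A us ≡ 0ℚ
arit-vanish B A us z =
  cong₂ _-_ (sum-zero _ (splits3 us) (λ t → termwise (termLeft-shape t)))
            (sum-zero _ (splits3 us) (λ t → termwise (termRight-shape t)))
  where
    termwise : ∀ {T total} → Shape T total → T A B ≡ 0ℚ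
    termwise (vanishes z′) = z′ A B
    termwise (product p ps Q e _) =
      trans (e A B) (trans (cong (_* B Q) (z p ps)) (solve 1 (λ b → con 0ℚ :* b := con 0ℚ) refl (B Q)))

splits-append : (w : List ℚ) → All (λ t → proj₁ t ++ proj₂ t ≡ w) (splits w)
splits-append [] = refl ∷ []
splits-append (u ∷ w) = refl ∷ gmap⁺ (cong (u ∷_)) (splits-append w)

splits3-flatten : (w : List ℚ) → All (λ t → flatten t ≡ w) (splits3 w)
splits3-flatten w = concat⁺ (gmap⁺ (λ {t} e →
  gmap⁺ (λ e′ → trans (cong (proj₁ t ++_) e′) e) (splits-append (proj₂ t))) (splits-append w))

-- Multiplying A by minus the sum of its arguments commutes with arit,
-- since the merges preserve the total sum.
arit-scaleByTotal : (B A : Mould) (us : List ℚ) →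
  arit B (λ vs → (- sumℚ vs) * A vs) us ≡ (- sumℚ us) * arit B A us
arit-scaleByTotal B A us = begin
    aritLeft B A′ us - aritRight B A′ us
  ≡⟨ cong₂ _-_
       (trans (sum-congᴬ _ _ _ (splits3 us) (splits3-flatten us) (λ t e → termwise (termLeft-shape t) (cong sumℚ e)))
              (sum-scale s (termLeft A B) (splits3 us)))
       (trans (sum-congᴬ _ _ _ (splits3 us) (splits3-flatten us) (λ t e → termwise (termRight-shape t) (cong sumℚ e)))
              (sum-scale s (termRight A B) (splits3 us))) ⟩
    s * aritLeft B A us - s * aritRight B A us
  ≡⟨ solve 3 (λ s a b → s :* a :- s :* b := s :* (a :- b)) refl s (aritLeft B A us) (aritRight B A us) ⟩
    s * arit B A us
  ∎
  where
    s = - sumℚ us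
    A′ : Mould
    A′ vs = (- sumℚ vs) * A vs
    termwise : ∀ {T total} → Shape T total → total ≡ sumℚ us → T A′ B ≡ s * T A B
    termwise (vanishes z) _ = trans (z A′ B) (sym (trans (cong (s *_) (z A B)) (solve 1 (λ s → s :* con 0ℚ := con 0ℚ) refl s)))
    termwise {T} (product p ps Q e σ) refl = begin
        T A′ B
      ≡⟨ e A′ B ⟩
        (- sumℚ (p ∷ ps)) * A (p ∷ ps) * B Q
      ≡⟨ cong (λ σ′ → (- σ′) * A (p ∷ ps) * B Q) σ ⟩
        s * A (p ∷ ps) * B Q
      ≡⟨ solve 3 (λ s a b → s :* a :* b := s :* (a :* b)) refl s (A (p ∷ ps)) (B Q) ⟩
        s * (A (p ∷ ps) * B Q)
      ≡⟨ cong (s *_) (sym (e A B)) ⟩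
        s * T A B
      ∎

sum-splits3-cons : (F : Triple → ℚ) (u : ℚ) (us : List ℚ) →
  sumℚ (map F (splits3 (u ∷ us))) ≡
    sumℚ (map (λ bc → F ([] , proj₁ bc , proj₂ bc)) (splits (u ∷ us)))
    + sumℚ (map (λ t → F (u ∷ proj₁ t , proj₂ t)) (splits3 us))
sum-splits3-cons F u us =
  trans (sum-++ F (withPrefix ([] , u ∷ us)) (concatMap withPrefix (map consU (splits us))))
    (cong₂ _+_ (sum-map-map F _ (splits (u ∷ us))) (shifted (splits us)))
  where
    withPrefix : List ℚ × List ℚ → List Triple
    withPrefix e = map (λ f → (proj₁ e , proj₁ f , proj₂ f)) (splits (proj₂ e))
    consU : List ℚ × List ℚ → List ℚ × List ℚ
    consU e = (u ∷ proj₁ e , proj₂ e)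
    shifted : (l : List (List ℚ × List ℚ)) →
      sumℚ (map F (concatMap withPrefix (map consU l))) ≡ sumℚ (map (λ t → F (u ∷ proj₁ t , proj₂ t)) (concatMap withPrefix l))
    shifted [] = refl
    shifted ((a , r) ∷ l) =
      trans (sum-++ F (withPrefix (u ∷ a , r)) (concatMap withPrefix (map consU l)))
      (trans (cong₂ _+_ (trans (sum-map-map F _ (splits r)) (sym (sum-map-map (λ t → F (u ∷ proj₁ t , proj₂ t)) _ (splits r))))
                        (shifted l))
        (sym (sum-++ (λ t → F (u ∷ proj₁ t , proj₂ t)) (withPrefix (a , r)) (concatMap withPrefix l))))

arit-cons : (B A A′ : Mould) (u : ℚ) (us : List ℚ) → (∀ v vs → A (v ∷ vs) ≡ A′ vs) →
  arit B A (u ∷ us) ≡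
    (arit B A′ us + sumℚ (map (λ bc → termL A B [] (proj₁ bc) (proj₂ bc)) (splits (u ∷ us))))
    - sumℚ (map (λ bc → termR A B (u ∷ []) (proj₁ bc) (proj₂ bc)) (splits us))
arit-cons B A A′ u us shift = begin
    aritLeft B A (u ∷ us) - aritRight B A (u ∷ us)
  ≡⟨ cong₂ _-_ (sum-splits3-cons (termLeft A B) u us) (sum-splits3-cons (termRight A B) u us) ⟩
    (X₁ + sumℚ (map (λ t → termLeft A B (u ∷ proj₁ t , proj₂ t)) (splits3 us)))
      - (sumℚ (map (λ bc → termRight A B ([] , proj₁ bc , proj₂ bc)) (splits (u ∷ us)))
         + sumℚ (map (λ t → termRight A B (u ∷ proj₁ t , proj₂ t)) (splits3 us)))
  ≡⟨ cong₂ (λ p q → (X₁ + p) - q)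
       (sum-cong _ _ (splits3 us) left)
       (cong₂ _+_ (sum-zero _ (splits (u ∷ us)) (λ _ → refl))
                  (trans (sum-cong _ _ (splits3 us) right) (sum-add (termRight A′ B) extra (splits3 us)))) ⟩
    (X₁ + aritLeft B A′ us) - (0ℚ + (aritRight B A′ us + sumℚ (map extra (splits3 us))))
  ≡⟨ cong (λ z → (X₁ + aritLeft B A′ us) - (0ℚ + (aritRight B A′ us + z))) (sum-extra us) ⟩
    (X₁ + aritLeft B A′ us) - (0ℚ + (aritRight B A′ us + X₂))
  ≡⟨ solve 4 (λ x₁ a b x₂ → (x₁ :+ a) :- (con 0ℚ :+ (b :+ x₂)) := ((a :- b) :+ x₁) :- x₂)
       refl X₁ (aritLeft B A′ us) (aritRight B A′ us) X₂ ⟩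
    (arit B A′ us + X₁) - X₂
  ∎
  where
    X₁ = sumℚ (map (λ bc → termL A B [] (proj₁ bc) (proj₂ bc)) (splits (u ∷ us)))
    X₂ = sumℚ (map (λ bc → termR A B (u ∷ []) (proj₁ bc) (proj₂ bc)) (splits us))
    left : ∀ t → termLeft A B (u ∷ proj₁ t , proj₂ t) ≡ termLeft A′ B t
    left (a , [] , c) = refl
    left (a , b ∷ bs , []) = refl
    left (a , b ∷ bs , c ∷ cs) = cong (_* B (b ∷ bs)) (shift u (a ++ ((sumℚ (b ∷ bs) + c) ∷ cs)))
    -- the right terms with a = (u), which have no counterpart for A′
    extra : Triple → ℚ
    extra ([] , b , c) = termR A B (u ∷ []) b c
    extra (_ ∷ _ , b , c) = 0ℚ
    right : ∀ t → termRight A B (u ∷ proj₁ t , proj₂ t) ≡ termRight A′ B t + extra t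
    right ([] , b , c) = solve 1 (λ a → a := con 0ℚ :+ a) refl (termR A B (u ∷ []) b c)
    right (a ∷ as , [] , c) = refl
    right (a ∷ as , b ∷ bs , c) rewrite shift u (addLast (sumℚ (b ∷ bs)) (a ∷ as) ++ c) =
      solve 1 (λ a → a := a :+ con 0ℚ) refl (A′ (addLast (sumℚ (b ∷ bs)) (a ∷ as) ++ c) * B (b ∷ bs))
    sum-extra : (us : List ℚ) → sumℚ (map extra (splits3 us)) ≡ sumℚ (map (λ bc → termR A B (u ∷ []) (proj₁ bc) (proj₂ bc)) (splits us))
    sum-extra [] = refl
    sum-extra (u′ ∷ us′) = trans (sum-splits3-cons extra u′ us′)
      (trans (cong (sumℚ (map (λ bc → termR A B (u ∷ []) (proj₁ bc) (proj₂ bc)) (splits (u′ ∷ us′))) +_)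
                   (sum-zero _ (splits3 us′) (λ _ → refl)))
        (solve 1 (λ a → a :+ con 0ℚ := a) refl _))

-- sel t ws f = f b c for the decomposition ws = b c with |b| = t (0 if none)
sel : ℕ → List ℚ → (List ℚ → List ℚ → ℚ) → ℚ
sel zero ws f = f [] ws
sel (suc t) [] f = 0ℚ
sel (suc t) (u ∷ ws) f = sel t ws (λ b c → f (u ∷ b) c)

sum-sel : (t : ℕ) (ws : List ℚ) (f : List ℚ → List ℚ → ℚ) → (∀ b c → ¬ (length b ≡ t) → f b c ≡ 0ℚ) →
  sumℚ (map (λ bc → f (proj₁ bc) (proj₂ bc)) (splits ws)) ≡ sel t ws f
sum-sel zero [] f z = solve 1 (λ a → a :+ con 0ℚ := a) refl (f [] [])
sum-sel (suc t) [] f z rewrite z [] [] (λ ()) = refl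
sum-sel t (u ∷ ws) f z =
  trans (cong (f [] (u ∷ ws) +_) (sum-map-map (λ bc → f (proj₁ bc) (proj₂ bc)) _ (splits ws))) (byLength t z)
  where
    byLength : (t : ℕ) → (∀ b c → ¬ (length b ≡ t) → f b c ≡ 0ℚ) →
      f [] (u ∷ ws) + sumℚ (map (λ bc → f (u ∷ proj₁ bc) (proj₂ bc)) (splits ws)) ≡ sel t (u ∷ ws) f
    byLength zero z = trans (cong (f [] (u ∷ ws) +_) (sum-zero _ (splits ws) (λ bc → z (u ∷ proj₁ bc) (proj₂ bc) (λ ()))))
      (solve 1 (λ a → a :+ con 0ℚ := a) refl (f [] (u ∷ ws)))
    byLength (suc t) z rewrite z [] (u ∷ ws) (λ ()) =
      trans (solve 1 (λ a → con 0ℚ :+ a := a) refl _)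
        (sum-sel t ws (λ b c → f (u ∷ b) c) (λ b c ne → z (u ∷ b) c (λ e → ne (cong ℕ.pred e))))

sel-cong : (t : ℕ) (ws : List ℚ) (f g : List ℚ → List ℚ → ℚ) → (∀ b c → length b ≡ t → f b c ≡ g b c) →
  sel t ws f ≡ sel t ws g
sel-cong zero ws f g e = e [] ws refl
sel-cong (suc t) [] f g e = refl
sel-cong (suc t) (u ∷ ws) f g e = sel-cong t ws _ _ (λ b c l → e (u ∷ b) c (cong suc l))

sel-scale : (k : ℚ) (t : ℕ) (ws : List ℚ) (f : List ℚ → List ℚ → ℚ) →
  k * sel t ws f ≡ sel t ws (λ b c → k * f b c)
sel-scale k zero ws f = refl
sel-scale k (suc t) [] f = solve 1 (λ k → k :* con 0ℚ := con 0ℚ) refl k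
sel-scale k (suc t) (u ∷ ws) f = sel-scale k t ws (λ b c → f (u ∷ b) c)

wordMould : Word → Mould
wordMould w vs = weight (levels vs) w

monWeight-sel : (m : CMon) (ws : List ℚ) (W : Word) →
  monWeight m ws W ≡ sel (length m) ws (λ b c → weight (levels c) W * monMould m b)
monWeight-sel [] ws W =
  trans (monWeight-nil ws W) (solve 1 (λ e → e := e :* (con 1ℚ :* con 1ℚ :+ con 0ℚ)) refl (weight (levels ws) W))
monWeight-sel (k ∷ ks) [] W = monWeight-exhausted k ks W
monWeight-sel (k ∷ ks) (u ∷ ws) W = begin
    monWeight (k ∷ ks) (u ∷ ws) W
  ≡⟨ trans (monWeight-cons k ks u ws W) (cong (powℚ (- u) k *_) (monWeight-sel ks ws W)) ⟩
    powℚ (- u) k * sel (length ks) ws (λ b c → weight (levels c) W * monMould ks b)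
  ≡⟨ sel-scale (powℚ (- u) k) (length ks) ws _ ⟩
    sel (length ks) ws (λ b c → powℚ (- u) k * (weight (levels c) W * monMould ks b))
  ≡⟨ sel-cong (length ks) ws _ _ (λ b c _ →
       trans (solve 3 (λ p e m → p :* (e :* m) := e :* (p :* m)) refl (powℚ (- u) k) (weight (levels c) W) (monMould ks b))
             (cong (weight (levels c) W *_) (sym (monMould-cons k ks u b)))) ⟩
    sel (length (k ∷ ks)) (u ∷ ws) (λ b c → weight (levels c) W * monMould (k ∷ ks) b)
  ∎

weight-single-level : (z : ℚ) (v r : Word) → weight (z ∷ []) (v ++ y ∷ r) ≡ 0ℚ
weight-single-level z [] r = refl
weight-single-level z (x ∷ v) r rewrite weight-single-level z v r = solve 1 (λ z → z :* con 0ℚ := con 0ℚ) refl z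
weight-single-level z (y ∷ v) r = refl

-- The boundary terms of arit-cons for A = wordMould (y w), B = monMould m,
-- restricted to the decompositions with |b| = |m| ...
monWeight-boundary-sel : (m : CMon) (u : ℚ) (us : List ℚ) (w : Word) →
  monWeight m us w - monWeight m (u ∷ us) (y ∷ w) ≡
    sel (length m) us (termR (wordMould (y ∷ w)) (monMould m) (u ∷ []))
    - sel (length m) (u ∷ us) (termL (wordMould (y ∷ w)) (monMould m) [])
monWeight-boundary-sel [] u us w =
  trans (cong₂ _-_ (monWeight-nil us w) (monWeight-nil (u ∷ us) (y ∷ w)))
        (solve 1 (λ a → a :- a := con 0ℚ :- con 0ℚ) refl (weight (levels us) w))
monWeight-boundary-sel m@(k ∷ ks) u us w =
  trans (cong₂ _-_ (monWeight-sel m us w) (monWeight-sel m (u ∷ us) (y ∷ w)))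
        (cong₂ _-_ (sel-cong (length m) us _ _ right) (sel-cong (length m) (u ∷ us) _ _ left))
  where
    right : ∀ b c → length b ≡ length m →
      weight (levels c) w * monMould m b ≡ termR (wordMould (y ∷ w)) (monMould m) (u ∷ []) b c
    right [] c ()
    right (b ∷ bs) c _ = refl
    left : ∀ b c → length b ≡ length m →
      weight (levels c) (y ∷ w) * monMould m b ≡ termL (wordMould (y ∷ w)) (monMould m) [] b c
    left [] c ()
    left (b ∷ bs) [] _ = solve 1 (λ a → con 0ℚ :* a := con 0ℚ) refl (monMould m (b ∷ bs))
    left (b ∷ bs) (c ∷ cs) _ = refl

-- ... which are all of them, since monMould m is concentrated in depth |m|
monWeight-boundary : (m : CMon) (u : ℚ) (us : List ℚ) (w : Word) →
  monWeight m us w - monWeight m (u ∷ us) (y ∷ w) ≡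
    sumℚ (map (λ bc → termR (wordMould (y ∷ w)) (monMould m) (u ∷ []) (proj₁ bc) (proj₂ bc)) (splits us))
    - sumℚ (map (λ bc → termL (wordMould (y ∷ w)) (monMould m) [] (proj₁ bc) (proj₂ bc)) (splits (u ∷ us)))
monWeight-boundary m u us w =
  trans (monWeight-boundary-sel m u us w)
        (sym (cong₂ _-_ (sum-sel (length m) us _ rightOutside) (sum-sel (length m) (u ∷ us) _ leftOutside)))
  where
    A = wordMould (y ∷ w)
    rightOutside : ∀ b c → ¬ (length b ≡ length m) → termR A (monMould m) (u ∷ []) b c ≡ 0ℚ
    rightOutside [] c ne = refl
    rightOutside (b ∷ bs) c ne rewrite monMould-depth m (b ∷ bs) ne =
      solve 1 (λ a → a :* con 0ℚ := con 0ℚ) refl (weight (levels c) w)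
    leftOutside : ∀ b c → ¬ (length b ≡ length m) → termL A (monMould m) [] b c ≡ 0ℚ
    leftOutside [] c ne = refl
    leftOutside (b ∷ bs) [] ne = refl
    leftOutside (b ∷ bs) (c ∷ cs) ne rewrite monMould-depth m (b ∷ bs) ne =
      solve 1 (λ a → a :* con 0ℚ := con 0ℚ) refl (weight (levels cs) w)

transposeD-monomial : (m : CMon) (w : Word) (us : List ℚ) →
  lin (DWordᵀ (weight (levels us)) w) (evalMon m) ≡ - arit (monMould m) (wordMould w) us
transposeD-monomial m [] us =
  trans (lin-zero _ (evalMon m) (λ _ → refl))
    (trans (solve 0 (con 0ℚ := :- con 0ℚ) refl)
      (cong -_ (sym (arit-vanish (monMould m) (wordMould []) us (λ v vs → refl)))))
transposeD-monomial m (x ∷ w) us = begin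
    lin (λ v → DWordᵀ (λ b → s * weight (levels us) b) w v) (evalMon m)
  ≡⟨ trans (lin-cong _ _ (evalMon m) (λ v → DWordᵀ-scale s (weight (levels us)) w v)) (lin-scale _ s (evalMon m)) ⟩
    s * lin (DWordᵀ (weight (levels us)) w) (evalMon m)
  ≡⟨ cong (s *_) (transposeD-monomial m w us) ⟩
    s * - arit (monMould m) (wordMould w) us
  ≡⟨ solve 2 (λ s a → s :* (:- a) := :- (s :* a)) refl s (arit (monMould m) (wordMould w) us) ⟩
    - (s * arit (monMould m) (wordMould w) us)
  ≡⟨ cong -_ (sym (arit-scaleByTotal (monMould m) (wordMould w) us)) ⟩
    - arit (monMould m) (wordMould (x ∷ w)) us
  ∎
  where s = - sumℚ us
transposeD-monomial m (y ∷ w) [] =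
  trans (lin-zero _ (evalMon m) (λ v →
          trans (cong₂ (λ a b → (0ℚ - a) + b) (weight-single-level (- 0ℚ) v w) (DWordᵀ-zero (λ b → 0ℚ) w v (λ _ → refl)))
                (solve 0 ((con 0ℚ :- con 0ℚ) :+ con 0ℚ := con 0ℚ) refl)))
    (solve 0 (con 0ℚ := :- ((con 0ℚ :+ con 0ℚ) :- (con 0ℚ :+ con 0ℚ))) refl)
transposeD-monomial m (y ∷ w) (u ∷ us) = begin
    lin (λ v → (weight (levels us) (v ++ w) - weight (levels (u ∷ us)) (v ++ y ∷ w))
               + DWordᵀ (weight (levels us)) w v) (evalMon m)
  ≡⟨ trans (lin-add _ _ (evalMon m)) (cong₂ _+_ (lin-sub _ _ (evalMon m)) (transposeD-monomial m w us)) ⟩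
    (monWeight m us w - monWeight m (u ∷ us) (y ∷ w)) + - arit B (wordMould w) us
  ≡⟨ cong (_+ - arit B (wordMould w) us) (monWeight-boundary m u us w) ⟩
    (S₂ - S₁) + - arit B (wordMould w) us
  ≡⟨ solve 3 (λ s₁ s₂ a → (s₂ :- s₁) :+ :- a := :- ((a :+ s₁) :- s₂)) refl S₁ S₂ (arit B (wordMould w) us) ⟩
    - ((arit B (wordMould w) us + S₁) - S₂)
  ≡⟨ cong -_ (sym (arit-cons B A (wordMould w) u us (λ v vs → refl))) ⟩
    - arit B A (u ∷ us)
  ∎
  where
    A = wordMould (y ∷ w)
    B = monMould m
    S₁ = sumℚ (map (λ bc → termL A B [] (proj₁ bc) (proj₂ bc)) (splits (u ∷ us)))
    S₂ = sumℚ (map (λ bc → termR A B (u ∷ []) (proj₁ bc) (proj₂ bc)) (splits us))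

arit-ma-expand : (f g : CPoly) (us : List ℚ) →
  arit (ma f) (ma g) us ≡ lin (λ w → lin (λ m → arit (monMould m) (wordMould w) us) f) (evalC g)
arit-ma-expand f g us = begin
    arit (ma f) (ma g) us
  ≡⟨ arit-cong (ma f) (λ vs → lin (λ m → monMould m vs) f) (ma g) (λ vs → lin (λ w → wordMould w vs) (evalC g)) us
       (λ vs → trans (ma-weight f vs) (lin-evalC (weight (levels vs)) f)) (λ vs → ma-weight g vs) ⟩
    arit (λ vs → lin (λ m → monMould m vs) f) (λ vs → lin (λ w → wordMould w vs) (evalC g)) us
  ≡⟨ arit-linˡ (λ vs → lin (λ m → monMould m vs) f) wordMould (evalC g) us ⟩
    lin (λ w → arit (λ vs → lin (λ m → monMould m vs) f) (wordMould w) us) (evalC g)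
  ≡⟨ lin-cong _ _ (evalC g) (λ w → arit-linʳ monMould (wordMould w) f us) ⟩
    lin (λ w → lin (λ m → arit (monMould m) (wordMould w) us) f) (evalC g)
  ∎

ma-Dder : (f g h : CPoly) → evalC h ≈P Dder (evalC f) (evalC g) → ma h ≈M negM (arit (ma f) (ma g))
ma-Dder f g h h≈Dfg us = begin
    ma h us
  ≡⟨ ma-weight h us ⟩
    lin φ (evalC h)
  ≡⟨ ≈P⇒lin (evalC h) (Dder (evalC f) (evalC g)) h≈Dfg φ ⟩
    lin φ (Dder (evalC f) (evalC g))
  ≡⟨ lin-Dder (evalC f) φ (evalC g) ⟩
    lin (λ w → lin φ (DWord (evalC f) w)) (evalC g)
  ≡⟨ lin-cong _ _ (evalC g) (λ w → trans (lin-DWord (evalC f) φ w) (lin-evalC (DWordᵀ φ w) f)) ⟩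
    lin (λ w → lin (λ m → lin (DWordᵀ φ w) (evalMon m)) f) (evalC g)
  ≡⟨ lin-cong _ _ (evalC g) (λ w → trans (lin-cong _ _ f (λ m → transposeD-monomial m w us)) (lin-neg _ f)) ⟩
    lin (λ w → - lin (λ m → arit (monMould m) (wordMould w) us) f) (evalC g)
  ≡⟨ lin-neg _ (evalC g) ⟩
    - lin (λ w → lin (λ m → arit (monMould m) (wordMould w) us) f) (evalC g)
  ≡⟨ cong -_ (sym (arit-ma-expand f g us)) ⟩
    - arit (ma f) (ma g) us
  ∎
  where φ = weight (levels us)

proposition3p3p3 : (n r m s : ℕ) (f g : CPoly)
    → HomogeneousP n r (evalC f)
    → HomogeneousP m s (evalC g)
    → (Σ CPoly (λ h → evalC h ≈P Dder (evalC f) (evalC g)))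
    × ((h : CPoly) → evalC h ≈P Dder (evalC f) (evalC g)
    → ma h ≈M negM (arit (ma f) (ma g)))
proposition3p3p3 _ _ _ _ f g _ _ = (bindC (DMon f) g , Dder-inC f g) , ma-Dder f g
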